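{- For every positive integer $n$, $$A_n(x)=\sum_{T\in \operatorname{SYT}(n)}\left(\prod_{i=1}^n \sigma_i(T)\right)x^{\ell(\lambda(T))}.$$
   Context: $A_n(x)=\sum_{\pi\in\mathfrak{S}_n}x^{{\rm des}(\pi)}$, where for $\pi=\pi_1\cdots\pi_n$ with $\pi_{n+1}=0$, ${\rm des}(\pi)=\#\{i\in[n]:\pi_i>\pi_{i+1}\}$ (so $A_1(x)=x$). $\operatorname{SYT}(n)$ is the set of standard Young tableaux with $n$ boxes (French convention: rows of weakly decreasing lengths from bottom to top, entries increasing along rows and up columns). $\ell(\lambda(T))$ is the number of rows of $T$. For $1\leqslant i\leqslant n$, $T_i$ is obtained from $T$ by deleting entries $i+1,\ldots,n$, and $\operatorname{col}_k(T_i)$ is the size of the $k$-th column of $T_i$; $\sigma_i(T)=i-\operatorname{col}_1(T_i)+1$ if $i$ lies in the first column of $T$, and $\sigma_i(T)=\operatorname{col}_k(T_i)-\operatorname{col}_{k+1}(T_i)+1$ if $i$ lies in the $(k+1)$-th column, $k\geqslant1$. -}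

module Defs where

open import Data.Nat using (ℕ; zero; suc; _+_; _*_; _∸_; _<ᵇ_; _≤ᵇ_; _≡ᵇ_)
open import Data.Bool using (Bool; true; false; _∧_; _∨_; not; if_then_else_)
open import Data.Nat.ListAction using (sum; product)
open import Data.List using (List; []; _∷_; map; concatMap; filter; length; upTo; foldr; _++_; take; drop)
open import Data.Maybe using (Maybe; just; nothing)
open import Relation.Nullary.Decidable using (Dec; yes; no)
open import Data.Bool using (T)
open import Data.Bool.Properties using (T?)

countᵇ : {A : Set} → (A → Bool) → List A → ℕ
countᵇ p []       = 0
countᵇ p (x ∷ xs) = (if p x then 1 else 0) + countᵇ p xs

filterᵇ : {A : Set} → (A → Bool) → List A → List A
filterᵇ p []       = []
filterᵇ p (x ∷ xs) = if p x then x ∷ filterᵇ p xs else filterᵇ p xs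

allᵇ : {A : Set} → (A → Bool) → List A → Bool
allᵇ p []       = true
allᵇ p (x ∷ xs) = p x ∧ allᵇ p xs

oneTo : ℕ → List ℕ
oneTo n = map suc (upTo n)

words : List ℕ → ℕ → List (List ℕ)
words as zero    = [] ∷ []
words as (suc k) = concatMap (λ a → map (a ∷_) (words as k)) as

elemᵇ : ℕ → List ℕ → Bool
elemᵇ x []       = false
elemᵇ x (y ∷ ys) = (x ≡ᵇ y) ∨ elemᵇ x ys

noDup : List ℕ → Bool
noDup []       = true
noDup (x ∷ xs) = not (elemᵇ x xs) ∧ noDup xs

perms : ℕ → List (List ℕ)
perms n = filterᵇ noDup (words (oneTo n) n)

-- des(π) = #{ i ∈ [n] : πᵢ > πᵢ₊₁ } with the convention πₙ₊₁ = 0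
des : List ℕ → ℕ
des []           = 0
des (x ∷ [])     = if 0 <ᵇ x then 1 else 0
des (x ∷ y ∷ xs) = (if y <ᵇ x then 1 else 0) + des (y ∷ xs)

-- Standard Young tableaux (French convention)
-- A tableau is the list of its rows, from bottom to top; each row is
-- the list of its entries from left to right.

Tableau : Set
Tableau = List (List ℕ)

compositions : ℕ → List (List ℕ)
compositions zero    = [] ∷ []
compositions (suc m) = concatMap extend (compositions m)
  where
  -- a composition of m+1 arises from one of m by either adding a new
  -- first part 1 or increasing the first part by 1
  extend : List ℕ → List (List ℕ)
  extend []       = (1 ∷ []) ∷ []
  extend (p ∷ ps) = (1 ∷ p ∷ ps) ∷ (suc p ∷ ps) ∷ []

cut : List ℕ → List ℕ → List (List ℕ)
cut []       xs = []
cut (l ∷ ls) xs = take l xs ∷ cut ls (drop l xs)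

strictlyIncreasing : List ℕ → Bool
strictlyIncreasing []           = true
strictlyIncreasing (x ∷ [])     = true
strictlyIncreasing (x ∷ y ∷ xs) = (x <ᵇ y) ∧ strictlyIncreasing (y ∷ xs)

columnsOK : List ℕ → List ℕ → Bool
columnsOK lower       []          = true
columnsOK []          (u ∷ us)    = false
columnsOK (d ∷ ds)    (u ∷ us)    = (d <ᵇ u) ∧ columnsOK ds us

nonEmpty : List ℕ → Bool
nonEmpty []      = false
nonEmpty (_ ∷ _) = true

isStandard : Tableau → Bool
isStandard []             = true
isStandard (r ∷ [])       = nonEmpty r ∧ strictlyIncreasing r
isStandard (r ∷ s ∷ rs)   =
  nonEmpty r ∧ strictlyIncreasing r ∧ (length s ≤ᵇ length r)
  ∧ columnsOK r s ∧ isStandard (s ∷ rs)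

-- Every tableau with entries 1..n is obtained exactly once by cutting
-- its row reading word (a permutation of [n]) according to its row lengths.
candidates : ℕ → List Tableau
candidates n = concatMap (λ π → map (λ c → cut c π) (compositions n)) (perms n)

SYT : ℕ → List Tableau
SYT n = filterᵇ isStandard (candidates n)

ℓ : Tableau → ℕ
ℓ T = length T

-- k-th entry (k ≥ 1) of a row, if present
entry : ℕ → List ℕ → Maybe ℕ
entry k       []       = nothing
entry zero    (x ∷ xs) = nothing
entry (suc zero)    (x ∷ xs) = just x
entry (suc (suc k)) (x ∷ xs) = entry (suc k) xs

-- col_k(T_i): number of cells of column k (k ≥ 1) with entry ≤ i
col : ℕ → Tableau → ℕ → ℕ
col k T i = countᵇ (λ r → cellLE (entry k r)) T
  where
  cellLE : Maybe ℕ → Bool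
  cellLE nothing  = false
  cellLE (just x) = x ≤ᵇ i

posInRow : ℕ → List ℕ → ℕ
posInRow i []       = 0
posInRow i (x ∷ xs) = if x ≡ᵇ i then 1 else (if elemᵇ i xs then suc (posInRow i xs) else 0)

-- column (1-based) of i in T, 0 if absent
columnOf : ℕ → Tableau → ℕ
columnOf i []       = 0
columnOf i (r ∷ rs) = if elemᵇ i r then posInRow i r else columnOf i rs

σ : ℕ → Tableau → ℕ
σ i T with columnOf i T
... | zero        = 0            -- i not in T (does not occur for i ∈ [n])
... | suc zero    = i ∸ col 1 T i + 1
... | suc (suc k) = col (suc k) T i ∸ col (suc (suc k)) T i + 1

weight : ℕ → Tableau → ℕ
weight n T = product (map (λ i → σ i T) (oneTo n))

-- [x^k] A_n(x)
eulerianCoeff : ℕ → ℕ → ℕ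
eulerianCoeff n k = countᵇ (λ π → des π ≡ᵇ k) (perms n)

-- [x^k] Σ_{T ∈ SYT(n)} (∏ σᵢ(T)) x^{ℓ(λ(T))}
sytCoeff : ℕ → ℕ → ℕ
sytCoeff n k = sum (map (weight n) (filterᵇ (λ T → ℓ T ≡ᵇ k) (SYT n)))

open import Relation.Binary.PropositionalEquality using (_≡_; refl)
private
  t1 : map (eulerianCoeff 3) (upTo 5) ≡ map (sytCoeff 3) (upTo 5)
  t1 = refl
  t1' : map (sytCoeff 3) (upTo 5) ≡ 0 ∷ 1 ∷ 4 ∷ 1 ∷ 0 ∷ []
  t1' = refl
  t2 : map (eulerianCoeff 4) (upTo 6) ≡ map (sytCoeff 4) (upTo 6)
  t2 = refl
  t3 : length (SYT 4) ≡ 10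
  t3 = refl

-- Test both sides against an arbitrary function h of the statistic (des, resp. the number of rows ℓ).
-- Every permutation of [n+1] arises exactly once by inserting n+1 into a permutation of [n], and every
-- SYT with n+1 cells exactly once by appending n+1 to an addable row of an SYT with n cells.  Inserting
-- n+1 into a permutation with d descents (with πₙ₊₁ = 0) keeps d descents when n+1 splits one of the
-- d descents and gives d+1 in the other n+1−d positions.  Appending n+1 to a tableau multiplies its weight by
-- σₙ₊₁: at the end of an existing row of length k this is the number of rows of length k, which sums to
-- ℓ over the addable rows, while a new row gives n+1−ℓ.  So both sums satisfy
--   ∑_{size n+1} h(stat) = ∑_{size n} (d·h(d) + (n+1−d)·h(d+1)) evaluated at d = stat,
-- and induction on n proves the identity for all h; h = [· = k] extracts the coefficients.

module Submission where

open import Defs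
open import Data.Nat using (ℕ; zero; suc; _+_; _*_; _∸_; _≤_; _<_; z≤n; s≤s; _<ᵇ_; _≤ᵇ_; _≡ᵇ_)
open import Data.Nat.Properties
open import Data.Nat.ListAction using (sum; product)
open import Data.Nat.ListAction.Properties using (sum-++; sum-↭; product-++)
open import Data.Bool using (Bool; true; false; _∧_; _∨_; if_then_else_; T)
open import Data.Bool.Properties using (T-≡; ∨-identityʳ)
open import Data.List using (List; []; _∷_; [_]; map; concatMap; concat; length; upTo; _++_; take; drop)
open import Data.List.Properties
  using (∷-injectiveʳ; length-++; length-take; length-drop; take++drop≡id; ++-assoc; map-++; upTo-∷ʳ; concatMap-cong)
open import Data.List.Membership.Propositional using (_∈_; _∉_; find; lose)
open import Data.List.Membership.Propositional.Properties
  using (∈-map⁺; ∈-map⁻; ∈-++⁺ˡ; ∈-++⁺ʳ; ∈-++⁻; ∈-∃++; ∈-upTo⁺; ∈-upTo⁻; ∈-concatMap⁺; ∈-concatMap⁻)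
open import Data.List.Membership.Propositional.Properties.WithK using (unique∧set⇒bag)
open import Data.List.Membership.DecPropositional _≟_ using (_∈?_)
open import Data.List.Relation.Unary.Any using (here; there)
open import Data.List.Relation.Unary.All as All using (All; []; _∷_)
open import Data.List.Relation.Unary.All.Properties using (¬Any⇒All¬; All¬⇒¬Any; map⁺; concat⁺; concat⁻; ++⁺; ++⁻ˡ; ++⁻ʳ)
open import Data.List.Relation.Unary.Unique.Propositional using (Unique)
open import Data.List.Relation.Unary.AllPairs using ([]; _∷_)
import Data.List.Relation.Unary.Unique.Propositional.Properties as Unique
open import Data.List.Relation.Binary.Permutation.Propositional using (_↭_; prep; swap; ↭-sym; ↭-refl; ↭-trans; ↭⇒↭ₛ)
open import Data.List.Relation.Binary.Permutation.Propositional.Properties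
  using (All-resp-↭; shift; ↭-length; ++⁺ˡ)
import Data.List.Relation.Binary.Permutation.Propositional.Properties as Perm
open import Data.List.Relation.Binary.BagAndSetEquality using (∼bag⇒↭)
open import Data.Maybe using (Maybe; just; nothing)
open import Data.Product using (∃; _×_; _,_; proj₁; proj₂)
open import Data.Sum using (_⊎_; inj₁; inj₂)
open import Data.Empty using (⊥)
open import Data.Unit using (tt)
open import Function using (_∘_; mk⇔; Equivalence)
open import Relation.Nullary using (¬_; yes; no; contradiction)
open import Relation.Binary.PropositionalEquality
  using (_≡_; _≢_; refl; sym; trans; cong; cong₂; subst; ≢-sym; setoid; module ≡-Reasoning)
open import Data.List.Relation.Binary.Permutation.Setoid.Properties (setoid ℕ) using (Unique-resp-↭)

∑ : {A : Set} → List A → (A → ℕ) → ℕ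
∑ xs f = sum (map f xs)

∑-++ : {A : Set} (xs ys : List A) (f : A → ℕ) → ∑ (xs ++ ys) f ≡ ∑ xs f + ∑ ys f
∑-++ xs ys f = trans (cong sum (map-++ f xs ys)) (sum-++ (map f xs) (map f ys))

∑-concatMap : {A B : Set} (g : A → List B) (xs : List A) (f : B → ℕ) →
  ∑ (concatMap g xs) f ≡ ∑ xs (λ x → ∑ (g x) f)
∑-concatMap g [] f = refl
∑-concatMap g (x ∷ xs) f = trans (∑-++ (g x) (concatMap g xs) f) (cong (∑ (g x) f +_) (∑-concatMap g xs f))

∑-map : {A B : Set} (h : A → B) (xs : List A) (f : B → ℕ) → ∑ (map h xs) f ≡ ∑ xs (f ∘ h)
∑-map h [] f = refl
∑-map h (x ∷ xs) f = cong (f (h x) +_) (∑-map h xs f)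

∑-cong : {A : Set} (xs : List A) {f g : A → ℕ} → (∀ {x} → x ∈ xs → f x ≡ g x) → ∑ xs f ≡ ∑ xs g
∑-cong [] eq = refl
∑-cong (x ∷ xs) eq = cong₂ _+_ (eq (here refl)) (∑-cong xs (eq ∘ there))

∑-*ˡ : {A : Set} (xs : List A) (c : ℕ) (f : A → ℕ) → ∑ xs (λ x → c * f x) ≡ c * ∑ xs f
∑-*ˡ [] c f = sym (*-zeroʳ c)
∑-*ˡ (x ∷ xs) c f = trans (cong (c * f x +_) (∑-*ˡ xs c f)) (sym (*-distribˡ-+ c (f x) _))

∑-*ʳ : {A : Set} (xs : List A) (c : ℕ) (f : A → ℕ) → ∑ xs (λ x → f x * c) ≡ ∑ xs f * c
∑-*ʳ xs c f = trans (∑-cong xs (λ {x} _ → *-comm (f x) c)) (trans (∑-*ˡ xs c f) (*-comm c (∑ xs f)))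

∑-filterᵇ : {A : Set} (p : A → Bool) (xs : List A) (f : A → ℕ) →
  ∑ (filterᵇ p xs) f ≡ ∑ xs (λ x → if p x then f x else 0)
∑-filterᵇ p [] f = refl
∑-filterᵇ p (x ∷ xs) f with p x
... | true  = cong (f x +_) (∑-filterᵇ p xs f)
... | false = ∑-filterᵇ p xs f

countᵇ≡∑ : {A : Set} (p : A → Bool) (xs : List A) → countᵇ p xs ≡ ∑ xs (λ x → if p x then 1 else 0)
countᵇ≡∑ p [] = refl
countᵇ≡∑ p (x ∷ xs) = cong (_ +_) (countᵇ≡∑ p xs)

∑-unique : {A : Set} {xs ys : List A} (f : A → ℕ) → Unique xs → Unique ys →
  (∀ {z} → z ∈ xs → z ∈ ys) → (∀ {z} → z ∈ ys → z ∈ xs) → ∑ xs f ≡ ∑ ys f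
∑-unique f uxs uys to from = sum-↭ (Perm.map⁺ f (∼bag⇒↭ (unique∧set⇒bag uxs uys (mk⇔ to from))))

product-cong : {A : Set} (xs : List A) {f g : A → ℕ} →
  (∀ {x} → x ∈ xs → f x ≡ g x) → product (map f xs) ≡ product (map g xs)
product-cong [] eq = refl
product-cong (x ∷ xs) eq = cong₂ _*_ (eq (here refl)) (product-cong xs (eq ∘ there))

Unique-resp-↭ₚ : {xs ys : List ℕ} → xs ↭ ys → Unique xs → Unique ys
Unique-resp-↭ₚ p = Unique-resp-↭ (↭⇒↭ₛ p)

∈-filterᵇ⁺ : {A : Set} (p : A → Bool) {x : A} (xs : List A) → x ∈ xs → p x ≡ true → x ∈ filterᵇ p xs
∈-filterᵇ⁺ p (y ∷ xs) (here refl) px rewrite px = here refl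
∈-filterᵇ⁺ p (y ∷ xs) (there x∈xs) px with p y
... | true  = there (∈-filterᵇ⁺ p xs x∈xs px)
... | false = ∈-filterᵇ⁺ p xs x∈xs px

∈-filterᵇ⁻ : {A : Set} (p : A → Bool) {x : A} (xs : List A) → x ∈ filterᵇ p xs → x ∈ xs × p x ≡ true
∈-filterᵇ⁻ p (y ∷ xs) x∈ with p y in py
∈-filterᵇ⁻ p (y ∷ xs) (here refl) | true = here refl , py
∈-filterᵇ⁻ p (y ∷ xs) (there x∈) | true = let x∈xs , px = ∈-filterᵇ⁻ p xs x∈ in there x∈xs , px
∈-filterᵇ⁻ p (y ∷ xs) x∈ | false = let x∈xs , px = ∈-filterᵇ⁻ p xs x∈ in there x∈xs , px

filterᵇ-unique : {A : Set} (p : A → Bool) (xs : List A) → Unique xs → Unique (filterᵇ p xs)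
filterᵇ-unique p [] u = u
filterᵇ-unique p (x ∷ xs) (x∉ ∷ u) with p x
... | true  = ¬Any⇒All¬ _ (All¬⇒¬Any x∉ ∘ proj₁ ∘ ∈-filterᵇ⁻ p xs) ∷ filterᵇ-unique p xs u
... | false = filterᵇ-unique p xs u

∈-concatMap⁺′ : {A B : Set} (g : A → List B) {x : A} {y : B} {xs : List A} → x ∈ xs → y ∈ g x → y ∈ concatMap g xs
∈-concatMap⁺′ g x∈xs y∈gx = ∈-concatMap⁺ g (lose x∈xs y∈gx)

∈-concatMap⁻′ : {A B : Set} (g : A → List B) {y : B} (xs : List A) → y ∈ concatMap g xs → ∃ λ x → x ∈ xs × y ∈ g x
∈-concatMap⁻′ g xs = find ∘ ∈-concatMap⁻ g

map-unique : {A B : Set} (h : A → B) (xs : List A) → Unique xs →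
  (∀ {x y} → x ∈ xs → y ∈ xs → h x ≡ h y → x ≡ y) → Unique (map h xs)
map-unique h [] u inj = []
map-unique h (x ∷ xs) (x∉ ∷ u) inj = ¬Any⇒All¬ _ hx∉ ∷ map-unique h xs u (λ p q → inj (there p) (there q))
  where
  hx∉ : h x ∉ map h xs
  hx∉ hx∈ with ∈-map⁻ h hx∈
  ... | y , y∈xs , hx≡hy = All¬⇒¬Any x∉ (subst (_∈ xs) (sym (inj (here refl) (there y∈xs) hx≡hy)) y∈xs)

-- key recovers from an element the member of xs whose block contains it, so the blocks are disjoint.
concatMap-unique : {A B : Set} (g : A → List B) (key : B → A) (xs : List A) → Unique xs →
  (∀ {x} → x ∈ xs → Unique (g x)) → (∀ {x y} → x ∈ xs → y ∈ g x → key y ≡ x) →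
  Unique (concatMap g xs)
concatMap-unique g key [] u ug k = []
concatMap-unique g key (x ∷ xs) (x∉ ∷ u) ug k =
  Unique.++⁺ (ug (here refl)) (concatMap-unique g key xs u (ug ∘ there) (k ∘ there)) disjoint
  where
  disjoint : ∀ {y} → y ∈ g x × y ∈ concatMap g xs → ⊥
  disjoint (y∈gx , y∈rest) with ∈-concatMap⁻′ g xs y∈rest
  ... | x′ , x′∈xs , y∈gx′ =
    All¬⇒¬Any x∉ (subst (_∈ xs) (trans (sym (k (there x′∈xs) y∈gx′)) (k (here refl) y∈gx)) x′∈xs)

Unique-++⁻ˡ : {A : Set} (xs ys : List A) → Unique (xs ++ ys) → Unique xs
Unique-++⁻ˡ [] ys u = []
Unique-++⁻ˡ (x ∷ xs) ys (x∉ ∷ u) = ++⁻ˡ xs x∉ ∷ Unique-++⁻ˡ xs ys u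

Unique-++⁻ʳ : {A : Set} (xs ys : List A) → Unique (xs ++ ys) → Unique ys
Unique-++⁻ʳ [] ys u = u
Unique-++⁻ʳ (x ∷ xs) ys (_ ∷ u) = Unique-++⁻ʳ xs ys u

Unique-++-disjoint : {A : Set} (xs ys : List A) {x : A} → Unique (xs ++ ys) → x ∈ xs → x ∉ ys
Unique-++-disjoint (_ ∷ xs) ys (x∉ ∷ u) (here refl) = All¬⇒¬Any (++⁻ʳ xs x∉)
Unique-++-disjoint (_ ∷ xs) ys (_ ∷ u) (there x∈xs) = Unique-++-disjoint xs ys u x∈xs

true-if-T : ∀ {b} → T b → b ≡ true
true-if-T = Equivalence.to T-≡

T-if-true : ∀ {b} → b ≡ true → T b
T-if-true = Equivalence.from T-≡

false-if-¬T : ∀ {b} → ¬ T b → b ≡ false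
false-if-¬T {false} _ = refl
false-if-¬T {true} ¬t = contradiction tt ¬t

∧-true⁻ : ∀ {a b} → a ∧ b ≡ true → a ≡ true × b ≡ true
∧-true⁻ {true} {true} _ = refl , refl

∧-true⁺ : ∀ {a b} → a ≡ true → b ≡ true → a ∧ b ≡ true
∧-true⁺ refl refl = refl

≡ᵇ-sound : ∀ {m n} → (m ≡ᵇ n) ≡ true → m ≡ n
≡ᵇ-sound = ≡ᵇ⇒≡ _ _ ∘ T-if-true

≡ᵇ-refl : ∀ n → (n ≡ᵇ n) ≡ true
≡ᵇ-refl n = true-if-T (≡⇒≡ᵇ n n refl)

≢⇒≡ᵇ-false : ∀ {m n} → m ≢ n → (m ≡ᵇ n) ≡ false
≢⇒≡ᵇ-false m≢n = false-if-¬T (m≢n ∘ ≡ᵇ⇒≡ _ _)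

<ᵇ-sound : ∀ {m n} → (m <ᵇ n) ≡ true → m < n
<ᵇ-sound = <ᵇ⇒< _ _ ∘ T-if-true

<⇒<ᵇ-true : ∀ {m n} → m < n → (m <ᵇ n) ≡ true
<⇒<ᵇ-true = true-if-T ∘ <⇒<ᵇ

≥⇒<ᵇ-false : ∀ {m n} → n ≤ m → (m <ᵇ n) ≡ false
≥⇒<ᵇ-false n≤m = false-if-¬T (λ t → <⇒≱ (<ᵇ⇒< _ _ t) n≤m)

<ᵇ-false⇒≥ : ∀ {m n} → (m <ᵇ n) ≡ false → n ≤ m
<ᵇ-false⇒≥ {m} {n} f = ≮⇒≥ (λ m<n → contradiction (trans (sym (<⇒<ᵇ-true m<n)) f) λ ())

≤ᵇ-sound : ∀ {m n} → (m ≤ᵇ n) ≡ true → m ≤ n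
≤ᵇ-sound = ≤ᵇ⇒≤ _ _ ∘ T-if-true

≤⇒≤ᵇ-true : ∀ {m n} → m ≤ n → (m ≤ᵇ n) ≡ true
≤⇒≤ᵇ-true = true-if-T ∘ ≤⇒≤ᵇ

>⇒≤ᵇ-false : ∀ {m n} → n < m → (m ≤ᵇ n) ≡ false
>⇒≤ᵇ-false n<m = false-if-¬T (λ t → <⇒≱ n<m (≤ᵇ⇒≤ _ _ t))

elemᵇ-sound : ∀ {x} xs → elemᵇ x xs ≡ true → x ∈ xs
elemᵇ-sound {x} (y ∷ xs) e with x ≡ᵇ y in x≡ᵇy
... | true  = here (≡ᵇ-sound x≡ᵇy)
... | false = there (elemᵇ-sound xs e)

∈⇒elemᵇ-true : ∀ {x} xs → x ∈ xs → elemᵇ x xs ≡ true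
∈⇒elemᵇ-true {x} (_ ∷ xs) (here refl) rewrite ≡ᵇ-refl x = refl
∈⇒elemᵇ-true {x} (y ∷ xs) (there x∈xs) rewrite ∈⇒elemᵇ-true xs x∈xs with x ≡ᵇ y
... | true  = refl
... | false = refl

∉⇒elemᵇ-false : ∀ {x} xs → x ∉ xs → elemᵇ x xs ≡ false
∉⇒elemᵇ-false xs x∉xs = false-if-¬T (x∉xs ∘ elemᵇ-sound xs ∘ true-if-T)

noDup-sound : ∀ xs → noDup xs ≡ true → Unique xs
noDup-sound [] _ = []
noDup-sound (x ∷ xs) e with elemᵇ x xs in x∈?
... | false = ¬Any⇒All¬ xs (λ x∈xs → contradiction (trans (sym (∈⇒elemᵇ-true xs x∈xs)) x∈?) λ ()) ∷ noDup-sound xs e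

Unique⇒noDup-true : ∀ xs → Unique xs → noDup xs ≡ true
Unique⇒noDup-true [] _ = refl
Unique⇒noDup-true (x ∷ xs) (x∉ ∷ u) rewrite ∉⇒elemᵇ-false xs (All¬⇒¬Any x∉) = Unique⇒noDup-true xs u

InRange : ℕ → ℕ → Set
InRange n x = 0 < x × x ≤ n

IsPermutation : ℕ → List ℕ → Set
IsPermutation n π = length π ≡ n × Unique π × All (InRange n) π

∈-oneTo⁻ : ∀ {n x} → x ∈ oneTo n → InRange n x
∈-oneTo⁻ x∈ with ∈-map⁻ suc x∈
... | i , i∈ , refl = s≤s z≤n , ∈-upTo⁻ i∈

∈-oneTo⁺ : ∀ {n x} → InRange n x → x ∈ oneTo n
∈-oneTo⁺ {x = suc x} (_ , x<n) = ∈-map⁺ suc (∈-upTo⁺ x<n)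

oneTo-unique : ∀ n → Unique (oneTo n)
oneTo-unique n = Unique.map⁺ suc-injective (Unique.upTo⁺ n)

∈-words⁺ : ∀ as k w → length w ≡ k → All (_∈ as) w → w ∈ words as k
∈-words⁺ as zero [] refl [] = here refl
∈-words⁺ as (suc k) (a ∷ w) refl (a∈ ∷ w⊆) =
  ∈-concatMap⁺′ (λ a → map (a ∷_) (words as k)) a∈ (∈-map⁺ (a ∷_) (∈-words⁺ as k w refl w⊆))

∈-words⁻ : ∀ as k w → w ∈ words as k → length w ≡ k × All (_∈ as) w
∈-words⁻ as zero w (here refl) = refl , []
∈-words⁻ as (suc k) w w∈ with ∈-concatMap⁻′ (λ a → map (a ∷_) (words as k)) as w∈
... | a , a∈ , w∈′ with ∈-map⁻ (a ∷_) w∈′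
... | w′ , w′∈ , refl = let len , w′⊆ = ∈-words⁻ as k w′ w′∈ in cong suc len , a∈ ∷ w′⊆

head₀ : List ℕ → ℕ
head₀ [] = 0
head₀ (x ∷ _) = x

words-unique : ∀ as k → Unique as → Unique (words as k)
words-unique as zero u = [] ∷ []
words-unique as (suc k) u = concatMap-unique (λ a → map (a ∷_) (words as k)) head₀ as u
  (λ _ → Unique.map⁺ ∷-injectiveʳ (words-unique as k u))
  (λ _ w∈ → let _ , _ , w≡ = ∈-map⁻ _ w∈ in cong head₀ w≡)

∈-perms⁻ : ∀ n π → π ∈ perms n → IsPermutation n π
∈-perms⁻ n π π∈ with ∈-filterᵇ⁻ noDup (words (oneTo n) n) π∈
... | π∈words , nd with ∈-words⁻ (oneTo n) n π π∈words
... | len , π⊆ = len , noDup-sound π nd , All.map ∈-oneTo⁻ π⊆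

∈-perms⁺ : ∀ n π → IsPermutation n π → π ∈ perms n
∈-perms⁺ n π (len , u , π⊆) = ∈-filterᵇ⁺ noDup (words (oneTo n) n)
  (∈-words⁺ (oneTo n) n π len (All.map ∈-oneTo⁺ π⊆)) (Unique⇒noDup-true π u)

perms-unique : ∀ n → Unique (perms n)
perms-unique n = filterᵇ-unique noDup _ (words-unique (oneTo n) n (oneTo-unique n))

InRange-suc : ∀ {n xs} → All (InRange n) xs → All (InRange (suc n)) xs
InRange-suc = All.map λ (0<x , x≤n) → 0<x , m≤n⇒m≤1+n x≤n

InRange-pred : ∀ {n xs} → All (suc n ≢_) xs → All (InRange (suc n)) xs → All (InRange n) xs
InRange-pred [] [] = []
InRange-pred (x≢ ∷ xs≢) ((0<x , x≤1+n) ∷ xs∈) =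
  (0<x , ≤-pred (≤∧≢⇒< x≤1+n (≢-sym x≢))) ∷ InRange-pred xs≢ xs∈

suc∉InRange : ∀ {n xs} → All (InRange n) xs → suc n ∉ xs
suc∉InRange (x∈ ∷ _) (here refl) = <⇒≱ (n<1+n _) (proj₂ x∈)
suc∉InRange (_ ∷ xs∈) (there n∈) = suc∉InRange xs∈ n∈

pigeonhole : ∀ n xs → Unique xs → All (InRange n) xs → length xs ≤ n
pigeonhole zero [] _ _ = z≤n
pigeonhole zero (x ∷ xs) _ ((0<x , x≤0) ∷ _) = contradiction x≤0 (<⇒≱ 0<x)
pigeonhole (suc n) xs u xs∈ with suc n ∈? xs
... | no n∉ = m≤n⇒m≤1+n (pigeonhole n xs u (InRange-pred (¬Any⇒All¬ xs n∉) xs∈))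
... | yes n∈ with ∈-∃++ n∈
... | as , bs , refl with Unique-resp-↭ₚ (shift (suc n) as bs) u | All-resp-↭ (shift (suc n) as bs) xs∈
... | n∉ ∷ u′ | _ ∷ rest∈ rewrite ↭-length (shift (suc n) as bs) =
  s≤s (pigeonhole n (as ++ bs) u′ (InRange-pred n∉ rest∈))

max∈permutation : ∀ n π → IsPermutation (suc n) π → suc n ∈ π
max∈permutation n π (len , u , π∈) with suc n ∈? π
... | yes n∈ = n∈
... | no n∉ = contradiction (pigeonhole n π u (InRange-pred (¬Any⇒All¬ π n∉) π∈))
                            (<⇒≱ (subst (n <_) (sym len) (n<1+n n)))

removeMax : ∀ {n π ρ} → π ↭ suc n ∷ ρ → IsPermutation (suc n) π → IsPermutation n ρ
removeMax p (len , u , π∈) with Unique-resp-↭ₚ p u | All-resp-↭ p π∈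
... | n∉ ∷ u′ | _ ∷ ρ∈ = suc-injective (trans (sym (↭-length p)) len) , u′ , InRange-pred n∉ ρ∈

addMax : ∀ {n π ρ} → π ↭ suc n ∷ ρ → IsPermutation n ρ → IsPermutation (suc n) π
addMax p (len , u , ρ∈) =
    trans (↭-length p) (cong suc len)
  , Unique-resp-↭ₚ (↭-sym p) (¬Any⇒All¬ _ (suc∉InRange ρ∈) ∷ u)
  , All-resp-↭ (↭-sym p) ((s≤s z≤n , ≤-refl) ∷ InRange-suc ρ∈)

mutual
  insertions : ℕ → List ℕ → List (List ℕ)
  insertions m xs = (m ∷ xs) ∷ laterInsertions m xs

  laterInsertions : ℕ → List ℕ → List (List ℕ)
  laterInsertions m [] = []
  laterInsertions m (x ∷ xs) = map (x ∷_) (insertions m xs)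

erase : ℕ → List ℕ → List ℕ
erase m [] = []
erase m (x ∷ xs) = if x ≡ᵇ m then erase m xs else x ∷ erase m xs

erase-∉ : ∀ m xs → m ∉ xs → erase m xs ≡ xs
erase-∉ m [] _ = refl
erase-∉ m (x ∷ xs) m∉ rewrite ≢⇒≡ᵇ-false {x} {m} (m∉ ∘ here ∘ sym) = cong (x ∷_) (erase-∉ m xs (m∉ ∘ there))

erase-snoc : ∀ m r → m ∉ r → erase m (r ++ [ m ]) ≡ r
erase-snoc m [] _ rewrite ≡ᵇ-refl m = refl
erase-snoc m (x ∷ r) m∉ rewrite ≢⇒≡ᵇ-false {x} {m} (m∉ ∘ here ∘ sym) = cong (x ∷_) (erase-snoc m r (m∉ ∘ there))

mutual
  erase-insertions : ∀ m xs {σ} → m ∉ xs → σ ∈ insertions m xs → erase m σ ≡ xs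
  erase-insertions m xs m∉ (here refl) rewrite ≡ᵇ-refl m = erase-∉ m xs m∉
  erase-insertions m xs m∉ (there σ∈) = erase-laterInsertions m xs m∉ σ∈

  erase-laterInsertions : ∀ m xs {σ} → m ∉ xs → σ ∈ laterInsertions m xs → erase m σ ≡ xs
  erase-laterInsertions m (x ∷ xs) m∉ σ∈ with ∈-map⁻ (x ∷_) σ∈
  ... | _ , σ′∈ , refl rewrite ≢⇒≡ᵇ-false {x} {m} (m∉ ∘ here ∘ sym) =
    cong (x ∷_) (erase-insertions m xs (m∉ ∘ there) σ′∈)

mutual
  insertions-↭ : ∀ m xs {σ} → σ ∈ insertions m xs → σ ↭ m ∷ xs
  insertions-↭ m xs (here refl) = ↭-refl
  insertions-↭ m xs (there σ∈) = laterInsertions-↭ m xs σ∈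

  laterInsertions-↭ : ∀ m xs {σ} → σ ∈ laterInsertions m xs → σ ↭ m ∷ xs
  laterInsertions-↭ m (x ∷ xs) σ∈ with ∈-map⁻ (x ∷_) σ∈
  ... | _ , σ′∈ , refl = ↭-trans (prep x (insertions-↭ m xs σ′∈)) (swap x m ↭-refl)

∈-insertions : ∀ m as bs → as ++ m ∷ bs ∈ insertions m (as ++ bs)
∈-insertions m [] bs = here refl
∈-insertions m (a ∷ as) bs = there (∈-map⁺ (a ∷_) (∈-insertions m as bs))

insertions-unique : ∀ m xs → m ∉ xs → Unique (insertions m xs)
insertions-unique m [] _ = [] ∷ []
insertions-unique m (x ∷ xs) m∉ =
  ¬Any⇒All¬ _ first∉ ∷ Unique.map⁺ ∷-injectiveʳ (insertions-unique m xs (m∉ ∘ there))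
  where
  first∉ : m ∷ x ∷ xs ∉ map (x ∷_) (insertions m xs)
  first∉ σ∈ with ∈-map⁻ (x ∷_) σ∈
  ... | _ , _ , refl = m∉ (here refl)

perms-suc⁺ : ∀ n {σ} → σ ∈ perms (suc n) → σ ∈ concatMap (insertions (suc n)) (perms n)
perms-suc⁺ n {σ} σ∈ with ∈-perms⁻ (suc n) σ σ∈
... | isPerm with ∈-∃++ (max∈permutation n σ isPerm)
... | as , bs , refl = ∈-concatMap⁺′ (insertions (suc n))
  (∈-perms⁺ n (as ++ bs) (removeMax (shift (suc n) as bs) isPerm)) (∈-insertions (suc n) as bs)

perms-suc⁻ : ∀ n {σ} → σ ∈ concatMap (insertions (suc n)) (perms n) → σ ∈ perms (suc n)
perms-suc⁻ n {σ} σ∈ with ∈-concatMap⁻′ (insertions (suc n)) (perms n) σ∈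
... | π , π∈ , σ∈ins = ∈-perms⁺ (suc n) σ (addMax (insertions-↭ (suc n) π σ∈ins) (∈-perms⁻ n π π∈))

max∉perm : ∀ n π → π ∈ perms n → suc n ∉ π
max∉perm n π π∈ = suc∉InRange (proj₂ (proj₂ (∈-perms⁻ n π π∈)))

insertions-perms-unique : ∀ n → Unique (concatMap (insertions (suc n)) (perms n))
insertions-perms-unique n = concatMap-unique (insertions (suc n)) (erase (suc n)) (perms n) (perms-unique n)
  (λ {π} π∈ → insertions-unique (suc n) π (max∉perm n π π∈))
  (λ {π} π∈ → erase-insertions (suc n) π (max∉perm n π π∈))

indicator : Bool → ℕ
indicator b = if b then 1 else 0

des-∷ : ∀ x ys → des (x ∷ ys) ≡ indicator (head₀ ys <ᵇ x) + des ys
des-∷ x [] = sym (+-identityʳ _)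
des-∷ x (y ∷ ys) = refl

des≤length : ∀ xs → des xs ≤ length xs
des≤length [] = z≤n
des≤length (x ∷ xs) rewrite des-∷ x xs with head₀ xs <ᵇ x
... | true  = s≤s (des≤length xs)
... | false = m≤n⇒m≤1+n (des≤length xs)

des-max∷ : ∀ m xs → 0 < m → All (_< m) xs → des (m ∷ xs) ≡ suc (des xs)
des-max∷ m [] 0<m _ rewrite <⇒<ᵇ-true 0<m = refl
des-max∷ m (x ∷ xs) _ (x<m ∷ _) rewrite <⇒<ᵇ-true x<m = refl

head₀-laterInsertions : ∀ m xs {ys} → ys ∈ laterInsertions m xs → head₀ ys ≡ head₀ xs
head₀-laterInsertions m (x ∷ xs) ys∈ with ∈-map⁻ (x ∷_) ys∈
... | _ , _ , refl = refl

-- The extra term is absorbed as one more ascent slot: (L ∸ d) + 1 = suc L ∸ d as d ≤ L.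
one-more-ascent : ∀ d L a b → d ≤ L → a + (d * b + (L ∸ d) * a) ≡ d * b + (suc L ∸ d) * a
one-more-ascent d L a b d≤L rewrite +-∸-assoc 1 d≤L = begin
    a + (d * b + (L ∸ d) * a) ≡⟨ sym (+-assoc a (d * b) _) ⟩
    a + d * b + (L ∸ d) * a   ≡⟨ cong (_+ (L ∸ d) * a) (+-comm a (d * b)) ⟩
    d * b + a + (L ∸ d) * a   ≡⟨ +-assoc (d * b) a _ ⟩
    d * b + (a + (L ∸ d) * a) ∎
  where open ≡-Reasoning

∑-des-laterInsertions : ∀ m xs (h : ℕ → ℕ) → 0 < m → All (_< m) xs →
  ∑ (laterInsertions m xs) (h ∘ des) ≡ des xs * h (des xs) + (length xs ∸ des xs) * h (suc (des xs))
∑-des-laterInsertions m [] h _ _ = refl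
∑-des-laterInsertions m (x ∷ xs) h 0<m (x<m ∷ xs<m) = begin
    ∑ (map (x ∷_) ((m ∷ xs) ∷ laterInsertions m xs)) (h ∘ des)
      ≡⟨ ∑-map (x ∷_) ((m ∷ xs) ∷ laterInsertions m xs) (h ∘ des) ⟩
    h (des (x ∷ m ∷ xs)) + ∑ (laterInsertions m xs) (λ ys → h (des (x ∷ ys)))
      ≡⟨ cong₂ _+_ (cong h des-x∷m∷xs) (∑-cong (laterInsertions m xs) (cong h ∘ des-x∷)) ⟩
    h (suc d) + ∑ (laterInsertions m xs) (λ ys → h (c + des ys))
      ≡⟨ cong (h (suc d) +_) (∑-des-laterInsertions m xs (h ∘ (c +_)) 0<m xs<m) ⟩
    h (suc d) + (d * h (c + d) + (length xs ∸ d) * h (c + suc d))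
      ≡⟨ collect ⟩
    des (x ∷ xs) * h (des (x ∷ xs)) + (length (x ∷ xs) ∸ des (x ∷ xs)) * h (suc (des (x ∷ xs))) ∎
  where
  open ≡-Reasoning
  d = des xs
  c = indicator (head₀ xs <ᵇ x)
  des-x∷m∷xs : des (x ∷ m ∷ xs) ≡ suc d
  des-x∷m∷xs rewrite ≥⇒<ᵇ-false {m} {x} (<⇒≤ x<m) = des-max∷ m xs 0<m xs<m
  des-x∷ : ∀ {ys} → ys ∈ laterInsertions m xs → des (x ∷ ys) ≡ c + des ys
  des-x∷ {ys} ys∈ = trans (des-∷ x ys) (cong (λ z → indicator (z <ᵇ x) + des ys) (head₀-laterInsertions m xs ys∈))
  collect : h (suc d) + (d * h (c + d) + (length xs ∸ d) * h (c + suc d))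
          ≡ des (x ∷ xs) * h (des (x ∷ xs)) + (length (x ∷ xs) ∸ des (x ∷ xs)) * h (suc (des (x ∷ xs)))
  collect rewrite des-∷ x xs with head₀ xs <ᵇ x
  ... | true  = sym (+-assoc (h (suc d)) _ _)
  ... | false = one-more-ascent d (length xs) (h (suc d)) (h d) (des≤length xs)

∑-des-insertions : ∀ m xs (h : ℕ → ℕ) → 0 < m → All (_< m) xs →
  ∑ (insertions m xs) (h ∘ des) ≡ des xs * h (des xs) + (suc (length xs) ∸ des xs) * h (suc (des xs))
∑-des-insertions m xs h 0<m xs<m = begin
    h (des (m ∷ xs)) + ∑ (laterInsertions m xs) (h ∘ des)
      ≡⟨ cong₂ _+_ (cong h (des-max∷ m xs 0<m xs<m)) (∑-des-laterInsertions m xs h 0<m xs<m) ⟩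
    h (suc (des xs)) + (des xs * h (des xs) + (length xs ∸ des xs) * h (suc (des xs)))
      ≡⟨ one-more-ascent (des xs) (length xs) _ _ (des≤length xs) ⟩
    des xs * h (des xs) + (suc (length xs) ∸ des xs) * h (suc (des xs)) ∎
  where open ≡-Reasoning

-- The recurrence shared by both sides, dualised to test functions h of the statistic.
step : ℕ → (ℕ → ℕ) → ℕ → ℕ
step n h d = d * h d + (suc n ∸ d) * h (suc d)

∑-des-perms-suc : ∀ n (h : ℕ → ℕ) → ∑ (perms (suc n)) (h ∘ des) ≡ ∑ (perms n) (step n h ∘ des)
∑-des-perms-suc n h = begin
    ∑ (perms (suc n)) (h ∘ des)
      ≡⟨ ∑-unique _ (perms-unique (suc n)) (insertions-perms-unique n) (perms-suc⁺ n) (perms-suc⁻ n) ⟩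
    ∑ (concatMap (insertions (suc n)) (perms n)) (h ∘ des)
      ≡⟨ ∑-concatMap (insertions (suc n)) (perms n) _ ⟩
    ∑ (perms n) (λ π → ∑ (insertions (suc n) π) (h ∘ des))
      ≡⟨ ∑-cong (perms n) insertStep ⟩
    ∑ (perms n) (step n h ∘ des) ∎
  where
  open ≡-Reasoning
  insertStep : ∀ {π} → π ∈ perms n → ∑ (insertions (suc n) π) (h ∘ des) ≡ step n h (des π)
  insertStep {π} π∈ with ∈-perms⁻ n π π∈
  ... | refl , _ , π∈range = ∑-des-insertions (suc n) π h (s≤s z≤n) (All.map (s≤s ∘ proj₂) π∈range)

IsComposition : ℕ → List ℕ → Set
IsComposition m c = All (0 <_) c × sum c ≡ m

extendComposition : List ℕ → List (List ℕ)
extendComposition [] = [ [ 1 ] ]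
extendComposition (p ∷ ps) = (1 ∷ p ∷ ps) ∷ (suc p ∷ ps) ∷ []

compositions-suc : ∀ m → compositions (suc m) ≡ concatMap extendComposition (compositions m)
compositions-suc m = concatMap-cong (λ { [] → refl ; (p ∷ ps) → refl }) (compositions m)

∈-compositions⁻ : ∀ m {c} → c ∈ compositions m → IsComposition m c
∈-compositions⁻ zero (here refl) = [] , refl
∈-compositions⁻ (suc m) {c} c∈ rewrite compositions-suc m
  with ∈-concatMap⁻′ extendComposition (compositions m) c∈
... | [] , c′∈ , here refl = s≤s z≤n ∷ [] , cong suc (proj₂ (∈-compositions⁻ m c′∈))
... | p ∷ ps , c′∈ , here refl =
  let pos , total = ∈-compositions⁻ m c′∈ in s≤s z≤n ∷ pos , cong suc total
... | p ∷ ps , c′∈ , there (here refl) with ∈-compositions⁻ m c′∈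
... | _ ∷ pos , total = s≤s z≤n ∷ pos , cong suc total

∈-compositions⁺ : ∀ m c → IsComposition m c → c ∈ compositions m
∈-compositions⁺ zero [] _ = here refl
∈-compositions⁺ zero (suc p ∷ c) (_ ∷ _ , ())
∈-compositions⁺ (suc m) c isComp rewrite compositions-suc m = go c isComp
  where
  go : ∀ c → IsComposition (suc m) c → c ∈ concatMap extendComposition (compositions m)
  go (1 ∷ []) (_ , total) =
    ∈-concatMap⁺′ extendComposition (∈-compositions⁺ m [] ([] , suc-injective total)) (here refl)
  go (1 ∷ q ∷ c) (_ ∷ pos , total) =
    ∈-concatMap⁺′ extendComposition (∈-compositions⁺ m (q ∷ c) (pos , suc-injective total)) (here refl)
  go (suc (suc p) ∷ c) (_ ∷ pos , total) =
    ∈-concatMap⁺′ extendComposition (∈-compositions⁺ m (suc p ∷ c) (s≤s z≤n ∷ pos , suc-injective total))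
      (there (here refl))

-- Left inverse of extendComposition on lists whose first part is positive.
unextendComposition : List ℕ → List ℕ
unextendComposition [] = []
unextendComposition (zero ∷ ps) = ps
unextendComposition (suc zero ∷ ps) = ps
unextendComposition (suc (suc p) ∷ ps) = suc p ∷ ps

compositions-unique : ∀ m → Unique (compositions m)
compositions-unique zero = [] ∷ []
compositions-unique (suc m) rewrite compositions-suc m =
  concatMap-unique extendComposition unextendComposition (compositions m) (compositions-unique m)
    extension-unique unextend∘extend
  where
  extension-unique : ∀ {c} → c ∈ compositions m → Unique (extendComposition c)
  extension-unique {[]} _ = [] ∷ []
  extension-unique {p ∷ ps} c∈ with ∈-compositions⁻ m c∈
  ... | s≤s _ ∷ _ , _ = ((λ ()) ∷ []) ∷ [] ∷ []
  unextend∘extend : ∀ {c y} → c ∈ compositions m → y ∈ extendComposition c → unextendComposition y ≡ c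
  unextend∘extend {[]} _ (here refl) = refl
  unextend∘extend {p ∷ ps} _ (here refl) = refl
  unextend∘extend {p ∷ ps} c∈ (there (here refl)) with ∈-compositions⁻ m c∈
  ... | s≤s _ ∷ _ , _ = refl

take-length-++ : ∀ (r s : List ℕ) → take (length r) (r ++ s) ≡ r
take-length-++ [] s = refl
take-length-++ (x ∷ r) s = cong (x ∷_) (take-length-++ r s)

drop-length-++ : ∀ (r s : List ℕ) → drop (length r) (r ++ s) ≡ s
drop-length-++ [] s = refl
drop-length-++ (x ∷ r) s = drop-length-++ r s

length-concat : ∀ (T : Tableau) → length (concat T) ≡ sum (map length T)
length-concat [] = refl
length-concat (r ∷ T) = trans (length-++ r) (cong (length r +_) (length-concat T))

cut-rowLengths : ∀ (T : Tableau) → cut (map length T) (concat T) ≡ T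
cut-rowLengths [] = refl
cut-rowLengths (r ∷ T) rewrite take-length-++ r (concat T) | drop-length-++ r (concat T) =
  cong (r ∷_) (cut-rowLengths T)

module _ (l : ℕ) (c π : List ℕ) (total : l + sum c ≡ length π) where
  sum-drop : sum c ≡ length (drop l π)
  sum-drop = trans (sym (m+n∸m≡n l (sum c))) (trans (cong (_∸ l) total) (sym (length-drop l π)))

  length-take-≡ : length (take l π) ≡ l
  length-take-≡ = trans (length-take l π) (m≤n⇒m⊓n≡m (subst (l ≤_) total (m≤m+n l (sum c))))

concat-cut : ∀ c π → sum c ≡ length π → concat (cut c π) ≡ π
concat-cut [] [] _ = refl
concat-cut (l ∷ c) π total =
  trans (cong (take l π ++_) (concat-cut c (drop l π) (sum-drop l c π total))) (take++drop≡id l π)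

rowLengths-cut : ∀ c π → sum c ≡ length π → map length (cut c π) ≡ c
rowLengths-cut [] π _ = refl
rowLengths-cut (l ∷ c) π total =
  cong₂ _∷_ (length-take-≡ l c π total) (rowLengths-cut c (drop l π) (sum-drop l c π total))

GoodRow : List ℕ → Set
GoodRow r = 0 < length r × strictlyIncreasing r ≡ true

FitsOn : List ℕ → List ℕ → Set
FitsOn r s = length s ≤ length r × columnsOK r s ≡ true

nonEmpty⇒0<length : ∀ r → nonEmpty r ≡ true → 0 < length r
nonEmpty⇒0<length (_ ∷ _) _ = s≤s z≤n

0<length⇒nonEmpty : ∀ r → 0 < length r → nonEmpty r ≡ true
0<length⇒nonEmpty (_ ∷ _) _ = refl

isStandard-[_]⁻ : ∀ r → isStandard [ r ] ≡ true → GoodRow r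
isStandard-[ r ]⁻ e with nonEmpty r in ne | strictlyIncreasing r
isStandard-[ r ]⁻ refl | true | true = nonEmpty⇒0<length r ne , refl

isStandard-[_]⁺ : ∀ r → GoodRow r → isStandard [ r ] ≡ true
isStandard-[ r ]⁺ (0<r , inc) rewrite 0<length⇒nonEmpty r 0<r | inc = refl

isStandard-∷∷⁻ : ∀ r s T → isStandard (r ∷ s ∷ T) ≡ true → GoodRow r × FitsOn r s × isStandard (s ∷ T) ≡ true
isStandard-∷∷⁻ r s T e with nonEmpty r in ne | strictlyIncreasing r | length s ≤ᵇ length r in le
                          | columnsOK r s | isStandard (s ∷ T)
... | true | true | true | true | true = (nonEmpty⇒0<length r ne , refl) , (≤ᵇ-sound le , refl) , refl

isStandard-∷∷⁺ : ∀ r s T → GoodRow r → FitsOn r s → isStandard (s ∷ T) ≡ true → isStandard (r ∷ s ∷ T) ≡ true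
isStandard-∷∷⁺ r s T (0<r , inc) (s≤r , cols) rest
  rewrite 0<length⇒nonEmpty r 0<r | inc | ≤⇒≤ᵇ-true s≤r | cols | rest = refl

isStandard-head : ∀ r T → isStandard (r ∷ T) ≡ true → GoodRow r
isStandard-head r [] st = isStandard-[ r ]⁻ st
isStandard-head r (s ∷ T) st = proj₁ (isStandard-∷∷⁻ r s T st)

isStandard-tail : ∀ r T → isStandard (r ∷ T) ≡ true → isStandard T ≡ true
isStandard-tail r [] _ = refl
isStandard-tail r (s ∷ T) st = proj₂ (proj₂ (isStandard-∷∷⁻ r s T st))

rows-nonEmpty : ∀ T → isStandard T ≡ true → All (λ r → 0 < length r) T
rows-nonEmpty [] _ = []
rows-nonEmpty (r ∷ T) st = proj₁ (isStandard-head r T st) ∷ rows-nonEmpty T (isStandard-tail r T st)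

rows-shorter : ∀ s T → isStandard (s ∷ T) ≡ true → All (λ r → length r ≤ length s) T
rows-shorter s [] _ = []
rows-shorter s (t ∷ T) st with isStandard-∷∷⁻ s t T st
... | _ , (t≤s , _) , st′ = t≤s ∷ All.map (λ r≤t → ≤-trans r≤t t≤s) (rows-shorter t T st′)

length≤length-concat : ∀ (T : Tableau) → All (λ r → 0 < length r) T → length T ≤ length (concat T)
length≤length-concat [] _ = z≤n
length≤length-concat (r ∷ T) (0<r ∷ rest) =
  subst (suc (length T) ≤_) (sym (length-++ r)) (+-mono-≤ 0<r (length≤length-concat T rest))

IsSYT : ℕ → Tableau → Set
IsSYT n T = isStandard T ≡ true × IsPermutation n (concat T)

∈-SYT⁻ : ∀ n T → T ∈ SYT n → IsSYT n T
∈-SYT⁻ n T T∈ with ∈-filterᵇ⁻ isStandard (candidates n) T∈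
... | T∈cand , st with ∈-concatMap⁻′ (λ π → map (λ c → cut c π) (compositions n)) (perms n) T∈cand
... | π , π∈ , T∈cuts with ∈-map⁻ (λ c → cut c π) T∈cuts
... | c , c∈ , refl = st , subst (IsPermutation n) (sym (concat-cut c π total)) isPerm
  where
  isPerm = ∈-perms⁻ n π π∈
  total = trans (proj₂ (∈-compositions⁻ n c∈)) (sym (proj₁ isPerm))

∈-SYT⁺ : ∀ n T → IsSYT n T → T ∈ SYT n
∈-SYT⁺ n T (st , isPerm) = ∈-filterᵇ⁺ isStandard (candidates n)
  (∈-concatMap⁺′ (λ π → map (λ c → cut c π) (compositions n)) (∈-perms⁺ n (concat T) isPerm)
    (subst (_∈ map (λ c → cut c (concat T)) (compositions n)) (cut-rowLengths T)
      (∈-map⁺ (λ c → cut c (concat T)) (∈-compositions⁺ n (map length T) shape))))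
  st
  where
  shape : IsComposition n (map length T)
  shape = map⁺ (rows-nonEmpty T st)
        , trans (sym (length-concat T)) (proj₁ isPerm)

SYT-unique : ∀ n → Unique (SYT n)
SYT-unique n = filterᵇ-unique isStandard (candidates n)
  (concatMap-unique (λ π → map (λ c → cut c π) (compositions n)) concat (perms n) (perms-unique n)
    cuts-unique concat-∈cuts)
  where
  total : ∀ {π c} → π ∈ perms n → c ∈ compositions n → sum c ≡ length π
  total π∈ c∈ = trans (proj₂ (∈-compositions⁻ n c∈)) (sym (proj₁ (∈-perms⁻ n _ π∈)))
  cuts-unique : ∀ {π} → π ∈ perms n → Unique (map (λ c → cut c π) (compositions n))
  cuts-unique {π} π∈ = map-unique _ _ (compositions-unique n) λ {c} {c′} c∈ c′∈ eq →
    trans (sym (rowLengths-cut c π (total π∈ c∈)))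
          (trans (cong (map length) eq) (rowLengths-cut c′ π (total π∈ c′∈)))
  concat-∈cuts : ∀ {π T} → π ∈ perms n → T ∈ map (λ c → cut c π) (compositions n) → concat T ≡ π
  concat-∈cuts {π} π∈ T∈ with ∈-map⁻ (λ c → cut c π) T∈
  ... | c , c∈ , refl = concat-cut c π (total π∈ c∈)

addToRow : ℕ → ℕ → Tableau → Tableau
addToRow m j [] = [ [ m ] ]
addToRow m zero (r ∷ T) = (r ++ [ m ]) ∷ T
addToRow m (suc j) (r ∷ T) = r ∷ addToRow m j T

-- The 0-based indices of the rows of Y that are shorter than the row below them,
-- where p is the length of the row below the first row of Y.
cornerRows′ : ℕ → Tableau → List ℕ
cornerRows′ p [] = []
cornerRows′ p (s ∷ Y) = (if length s <ᵇ p then [ 0 ] else []) ++ map suc (cornerRows′ (length s) Y)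

cornerRows : Tableau → List ℕ
cornerRows [] = []
cornerRows (r ∷ Y) = 0 ∷ map suc (cornerRows′ (length r) Y)

addableRows′ : ℕ → Tableau → List ℕ
addableRows′ p Y = cornerRows′ p Y ++ [ length Y ]

addableRows : Tableau → List ℕ
addableRows T = cornerRows T ++ [ length T ]

growths : ℕ → Tableau → List Tableau
growths m T = map (λ j → addToRow m j T) (addableRows T)

∈-addableRows′-[] : ∀ p {j} → j ∈ addableRows′ p [] → j ≡ 0
∈-addableRows′-[] p (here refl) = refl

∈-addableRows′-∷⁻ : ∀ p s Y {j} → j ∈ addableRows′ p (s ∷ Y) →
  (j ≡ 0 × length s < p) ⊎ ∃ λ j′ → j ≡ suc j′ × j′ ∈ addableRows′ (length s) Y
∈-addableRows′-∷⁻ p s Y j∈ with ∈-++⁻ (cornerRows′ p (s ∷ Y)) j∈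
... | inj₂ (here refl) = inj₂ (length Y , refl , ∈-++⁺ʳ _ (here refl))
... | inj₁ j∈corners with length s <ᵇ p in s<p | ∈-++⁻ (if length s <ᵇ p then [ 0 ] else []) j∈corners
... | true | inj₁ (here refl) = inj₁ (refl , <ᵇ-sound s<p)
... | _ | inj₂ j∈suc with ∈-map⁻ suc j∈suc
... | j′ , j′∈ , refl = inj₂ (j′ , refl , ∈-++⁺ˡ j′∈)

0∈addableRows′ : ∀ p s Y → length s < p → 0 ∈ addableRows′ p (s ∷ Y)
0∈addableRows′ p s Y s<p rewrite <⇒<ᵇ-true s<p = here refl

suc∈addableRows′ : ∀ p s Y {j′} → j′ ∈ addableRows′ (length s) Y → suc j′ ∈ addableRows′ p (s ∷ Y)
suc∈addableRows′ p s Y j′∈ with ∈-++⁻ (cornerRows′ (length s) Y) j′∈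
... | inj₁ j′∈corners = ∈-++⁺ˡ (∈-++⁺ʳ (if length s <ᵇ p then [ 0 ] else []) (∈-map⁺ suc j′∈corners))
... | inj₂ (here refl) = ∈-++⁺ʳ _ (here refl)

∈-addableRows-∷⁻ : ∀ r Y {j} → j ∈ addableRows (r ∷ Y) →
  j ≡ 0 ⊎ ∃ λ j′ → j ≡ suc j′ × j′ ∈ addableRows′ (length r) Y
∈-addableRows-∷⁻ r Y (here refl) = inj₁ refl
∈-addableRows-∷⁻ r Y (there j∈) with ∈-++⁻ (map suc (cornerRows′ (length r) Y)) j∈
... | inj₂ (here refl) = inj₂ (length Y , refl , ∈-++⁺ʳ _ (here refl))
... | inj₁ j∈suc with ∈-map⁻ suc j∈suc
... | j′ , j′∈ , refl = inj₂ (j′ , refl , ∈-++⁺ˡ j′∈)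

suc∈addableRows : ∀ r Y {j′} → j′ ∈ addableRows′ (length r) Y → suc j′ ∈ addableRows (r ∷ Y)
suc∈addableRows r Y j′∈ with ∈-++⁻ (cornerRows′ (length r) Y) j′∈
... | inj₁ j′∈corners = there (∈-++⁺ˡ (∈-map⁺ suc j′∈corners))
... | inj₂ (here refl) = there (∈-++⁺ʳ _ (here refl))

length-snoc : ∀ (r : List ℕ) m → length (r ++ [ m ]) ≡ suc (length r)
length-snoc r m = trans (length-++ r) (+-comm (length r) 1)

strictlyIncreasing-tail : ∀ x xs → strictlyIncreasing (x ∷ xs) ≡ true → strictlyIncreasing xs ≡ true
strictlyIncreasing-tail x [] _ = refl
strictlyIncreasing-tail x (y ∷ xs) inc = proj₂ (∧-true⁻ {x <ᵇ y} inc)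

strictlyIncreasing-snoc : ∀ m r → strictlyIncreasing r ≡ true → All (_< m) r → strictlyIncreasing (r ++ [ m ]) ≡ true
strictlyIncreasing-snoc m [] _ _ = refl
strictlyIncreasing-snoc m (x ∷ []) _ (x<m ∷ _) = ∧-true⁺ (<⇒<ᵇ-true x<m) refl
strictlyIncreasing-snoc m (x ∷ y ∷ r) inc (_ ∷ r<m) with ∧-true⁻ {x <ᵇ y} inc
... | x<y , inc′ = ∧-true⁺ x<y (strictlyIncreasing-snoc m (y ∷ r) inc′ r<m)

strictlyIncreasing-++⁻ˡ : ∀ r s → strictlyIncreasing (r ++ s) ≡ true → strictlyIncreasing r ≡ true
strictlyIncreasing-++⁻ˡ [] s _ = refl
strictlyIncreasing-++⁻ˡ (x ∷ []) s _ = refl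
strictlyIncreasing-++⁻ˡ (x ∷ y ∷ r) s inc =
  ∧-true⁺ (proj₁ (∧-true⁻ {x <ᵇ y} inc)) (strictlyIncreasing-++⁻ˡ (y ∷ r) s (proj₂ (∧-true⁻ {x <ᵇ y} inc)))

max-last : ∀ m r → strictlyIncreasing r ≡ true → All (_≤ m) r → m ∈ r → ∃ λ r₀ → r ≡ r₀ ++ [ m ]
max-last m (x ∷ []) _ _ (here refl) = [] , refl
max-last m (x ∷ y ∷ xs) inc (_ ∷ y≤m ∷ _) (here refl) =
  contradiction y≤m (<⇒≱ (<ᵇ-sound (proj₁ (∧-true⁻ {x <ᵇ y} inc))))
max-last m (x ∷ xs) inc (_ ∷ xs≤m) (there m∈) with max-last m xs (strictlyIncreasing-tail x xs inc) xs≤m m∈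
... | r₀ , refl = x ∷ r₀ , refl

columnsOK-++ˡ : ∀ r s t → columnsOK r s ≡ true → columnsOK (r ++ t) s ≡ true
columnsOK-++ˡ r [] t _ = refl
columnsOK-++ˡ (d ∷ r) (u ∷ s) t ok with ∧-true⁻ {d <ᵇ u} ok
... | d<u , ok′ = ∧-true⁺ d<u (columnsOK-++ˡ r s t ok′)

columnsOK-++⁻ʳ : ∀ r s t → columnsOK r (s ++ t) ≡ true → columnsOK r s ≡ true
columnsOK-++⁻ʳ r [] t _ = refl
columnsOK-++⁻ʳ (d ∷ r) (u ∷ s) t ok with ∧-true⁻ {d <ᵇ u} ok
... | d<u , ok′ = ∧-true⁺ d<u (columnsOK-++⁻ʳ r s t ok′)

columnsOK-snoc : ∀ m r s → columnsOK r s ≡ true → length s < length r → All (_< m) r → columnsOK r (s ++ [ m ]) ≡ true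
columnsOK-snoc m (d ∷ r) [] _ _ (d<m ∷ _) = ∧-true⁺ (<⇒<ᵇ-true d<m) refl
columnsOK-snoc m (d ∷ r) (u ∷ s) ok (s≤s s<r) (_ ∷ r<m) with ∧-true⁻ {d <ᵇ u} ok
... | d<u , ok′ = ∧-true⁺ d<u (columnsOK-snoc m r s ok′ s<r r<m)

-- No entry ≤ m fits above the cell of m.
columnsOK-below-max : ∀ m r₀ s → columnsOK (r₀ ++ [ m ]) s ≡ true → All (_≤ m) s → length s ≤ length r₀
columnsOK-below-max m r₀ [] _ _ = z≤n
columnsOK-below-max m [] (u ∷ s) ok (u≤m ∷ _) = contradiction u≤m (<⇒≱ (<ᵇ-sound (proj₁ (∧-true⁻ {m <ᵇ u} ok))))
columnsOK-below-max m (d ∷ r₀) (u ∷ s) ok (_ ∷ s≤m) =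
  s≤s (columnsOK-below-max m r₀ s (proj₂ (∧-true⁻ {d <ᵇ u} ok)) s≤m)

columnsOK-++⁻ˡ : ∀ r₀ t s → columnsOK (r₀ ++ t) s ≡ true → length s ≤ length r₀ → columnsOK r₀ s ≡ true
columnsOK-++⁻ˡ r₀ t [] _ _ = refl
columnsOK-++⁻ˡ (d ∷ r₀) t (u ∷ s) ok (s≤s s≤r₀) with ∧-true⁻ {d <ᵇ u} ok
... | d<u , ok′ = ∧-true⁺ d<u (columnsOK-++⁻ˡ r₀ t s ok′ s≤r₀)

GoodRow-snoc : ∀ m r → GoodRow r → All (_< m) r → GoodRow (r ++ [ m ])
GoodRow-snoc m r (_ , inc) r<m = subst (0 <_) (sym (length-snoc r m)) (s≤s z≤n) , strictlyIncreasing-snoc m r inc r<m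

isStandard-snocFirst : ∀ m r Y → isStandard (r ∷ Y) ≡ true → All (_< m) r → isStandard ((r ++ [ m ]) ∷ Y) ≡ true
isStandard-snocFirst m r [] st r<m = isStandard-[ r ++ [ m ] ]⁺ (GoodRow-snoc m r (isStandard-[ r ]⁻ st) r<m)
isStandard-snocFirst m r (s ∷ Y) st r<m with isStandard-∷∷⁻ r s Y st
... | good , (s≤r , ok) , st′ = isStandard-∷∷⁺ (r ++ [ m ]) s Y (GoodRow-snoc m r good r<m)
  (≤-trans s≤r (subst (length r ≤_) (sym (length-snoc r m)) (n≤1+n _)) , columnsOK-++ˡ r s [ m ] ok) st′

isStandard-addToRow′ : ∀ m r Y j → isStandard (r ∷ Y) ≡ true → All (_< m) r → All (All (_< m)) Y →
  j ∈ addableRows′ (length r) Y → isStandard (r ∷ addToRow m j Y) ≡ true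
isStandard-addToRow′ m [] [] j st _ _ _ = contradiction (proj₁ (isStandard-[ [] ]⁻ st)) λ ()
isStandard-addToRow′ m r@(_ ∷ _) [] j st (d<m ∷ _) _ j∈ with ∈-addableRows′-[] (length r) j∈
... | refl = isStandard-∷∷⁺ r [ m ] [] (isStandard-[ r ]⁻ st) (s≤s z≤n , ∧-true⁺ (<⇒<ᵇ-true d<m) refl) refl
isStandard-addToRow′ m r (s ∷ Y) j st r<m (s<m ∷ Y<m) j∈
  with isStandard-∷∷⁻ r s Y st | ∈-addableRows′-∷⁻ (length r) s Y j∈
... | good , (_ , ok) , st′ | inj₁ (refl , s<r) =
  isStandard-∷∷⁺ r (s ++ [ m ]) Y good (subst (_≤ length r) (sym (length-snoc s m)) s<r , columnsOK-snoc m r s ok s<r r<m)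
    (isStandard-snocFirst m s Y st′ s<m)
... | good , fits , st′ | inj₂ (j′ , refl , j′∈) =
  isStandard-∷∷⁺ r s (addToRow m j′ Y) good fits (isStandard-addToRow′ m s Y j′ st′ s<m Y<m j′∈)

isStandard-addToRow : ∀ m T j → isStandard T ≡ true → All (All (_< m)) T → j ∈ addableRows T →
  isStandard (addToRow m j T) ≡ true
isStandard-addToRow m [] j _ _ (here refl) = refl
isStandard-addToRow m (r ∷ Y) j st (r<m ∷ Y<m) j∈ with ∈-addableRows-∷⁻ r Y j∈
... | inj₁ refl = isStandard-snocFirst m r Y st r<m
... | inj₂ (j′ , refl , j′∈) = isStandard-addToRow′ m r Y j′ st r<m Y<m j′∈

removeEntry : ℕ → Tableau → Tableau
removeEntry m [] = []
removeEntry m (r ∷ T) = if nonEmpty (erase m r) then erase m r ∷ removeEntry m T else removeEntry m T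

rowOf : ℕ → Tableau → ℕ
rowOf m [] = 0
rowOf m (r ∷ T) = if elemᵇ m r then 0 else suc (rowOf m T)

removeEntry-∷ : ∀ m r X → 0 < length r → m ∉ r → removeEntry m (r ∷ X) ≡ r ∷ removeEntry m X
removeEntry-∷ m r@(_ ∷ _) X _ m∉ rewrite erase-∉ m r m∉ = refl

removeEntry-∉ : ∀ m T → All (λ r → 0 < length r) T → m ∉ concat T → removeEntry m T ≡ T
removeEntry-∉ m [] _ _ = refl
removeEntry-∉ m (r ∷ T) (0<r ∷ rest) m∉ =
  trans (removeEntry-∷ m r T 0<r (m∉ ∘ ∈-++⁺ˡ)) (cong (r ∷_) (removeEntry-∉ m T rest (m∉ ∘ ∈-++⁺ʳ r)))

removeEntry-addToRow : ∀ m j T → All (λ r → 0 < length r) T → m ∉ concat T → removeEntry m (addToRow m j T) ≡ T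
removeEntry-addToRow m j [] _ _ rewrite ≡ᵇ-refl m = refl
removeEntry-addToRow m zero (r@(_ ∷ _) ∷ T) (_ ∷ rest) m∉ rewrite erase-snoc m r (m∉ ∘ ∈-++⁺ˡ) =
  cong (r ∷_) (removeEntry-∉ m T rest (m∉ ∘ ∈-++⁺ʳ r))
removeEntry-addToRow m (suc j) (r ∷ T) (0<r ∷ rest) m∉ =
  trans (removeEntry-∷ m r (addToRow m j T) 0<r (m∉ ∘ ∈-++⁺ˡ))
        (cong (r ∷_) (removeEntry-addToRow m j T rest (m∉ ∘ ∈-++⁺ʳ r)))

rowOf-addToRow : ∀ m j T → j ≤ length T → m ∉ concat T → rowOf m (addToRow m j T) ≡ j
rowOf-addToRow m zero [] _ _ rewrite ≡ᵇ-refl m = refl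
rowOf-addToRow m zero (r ∷ T) _ m∉ rewrite ∈⇒elemᵇ-true (r ++ [ m ]) (∈-++⁺ʳ r (here refl)) = refl
rowOf-addToRow m (suc j) (r ∷ T) (s≤s j≤T) m∉ rewrite ∉⇒elemᵇ-false r (m∉ ∘ ∈-++⁺ˡ) =
  cong suc (rowOf-addToRow m j T j≤T (m∉ ∘ ∈-++⁺ʳ r))

addToRow-↭ : ∀ m j T → concat (addToRow m j T) ↭ m ∷ concat T
addToRow-↭ m j [] = ↭-refl
addToRow-↭ m zero (r ∷ T) rewrite ++-assoc r [ m ] (concat T) = shift m r (concat T)
addToRow-↭ m (suc j) (r ∷ T) = ↭-trans (++⁺ˡ r (addToRow-↭ m j T)) (shift m r (concat T))

cornerRows′<length : ∀ p Y {j} → j ∈ cornerRows′ p Y → j < length Y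
cornerRows′<length p (s ∷ Y) j∈ with ∈-++⁻ (if length s <ᵇ p then [ 0 ] else []) j∈
... | inj₂ j∈suc with ∈-map⁻ suc j∈suc
...   | j′ , j′∈ , refl = s≤s (cornerRows′<length (length s) Y j′∈)
cornerRows′<length p (s ∷ Y) j∈ | inj₁ _ with length s <ᵇ p
cornerRows′<length p (s ∷ Y) j∈ | inj₁ (here refl) | true = s≤s z≤n

cornerRows<length : ∀ Y {j} → j ∈ cornerRows Y → j < length Y
cornerRows<length (r ∷ Y) (here refl) = s≤s z≤n
cornerRows<length (r ∷ Y) (there j∈) with ∈-map⁻ suc j∈
... | j′ , j′∈ , refl = s≤s (cornerRows′<length (length r) Y j′∈)

addableRows≤length : ∀ T {j} → j ∈ addableRows T → j ≤ length T
addableRows≤length T j∈ with ∈-++⁻ (cornerRows T) j∈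
... | inj₁ j∈corners = <⇒≤ (cornerRows<length T j∈corners)
... | inj₂ (here refl) = ≤-refl

0∉map-suc : ∀ xs → 0 ∉ map suc xs
0∉map-suc xs 0∈ with ∈-map⁻ suc 0∈
... | _ , _ , ()

cornerRows′-unique : ∀ p Y → Unique (cornerRows′ p Y)
cornerRows′-unique p [] = []
cornerRows′-unique p (s ∷ Y) with length s <ᵇ p
... | true  = ¬Any⇒All¬ _ (0∉map-suc _) ∷ Unique.map⁺ suc-injective (cornerRows′-unique (length s) Y)
... | false = Unique.map⁺ suc-injective (cornerRows′-unique (length s) Y)

addableRows-unique : ∀ T → Unique (addableRows T)
addableRows-unique T = Unique.++⁺ (cornerRows-unique T) ([] ∷ []) λ { (j∈ , here refl) → <-irrefl refl (cornerRows<length T j∈) }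
  where
  cornerRows-unique : ∀ T → Unique (cornerRows T)
  cornerRows-unique [] = []
  cornerRows-unique (r ∷ Y) = ¬Any⇒All¬ _ (0∉map-suc _) ∷ Unique.map⁺ suc-injective (cornerRows′-unique (length r) Y)

Growth : ℕ → Tableau → Tableau → Set
Growth m T T′ = isStandard T ≡ true × ∃ λ j → j ∈ addableRows T × T′ ≡ addToRow m j T

Growth-∷ : ∀ m r R j → isStandard (r ∷ addToRow m j R) ≡ true → isStandard R ≡ true → j ∈ addableRows R →
  Growth m (r ∷ R) (r ∷ addToRow m j R)
Growth-∷ m r [] j st _ (here refl) =
  isStandard-[ r ]⁺ (proj₁ (isStandard-∷∷⁻ r [ m ] [] st)) , suc zero , there (here refl) , refl
Growth-∷ m r (s ∷ R) j st stR j∈ with ∈-addableRows-∷⁻ s R j∈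
... | inj₁ refl with isStandard-∷∷⁻ r (s ++ [ m ]) R st
... | good , (s+1≤r , ok) , _ =
  isStandard-∷∷⁺ r s R good (<⇒≤ s<r , columnsOK-++⁻ʳ r s [ m ] ok) stR ,
  suc zero , suc∈addableRows r (s ∷ R) (0∈addableRows′ (length r) s R s<r) , refl
  where
  s<r : length s < length r
  s<r = subst (_≤ length r) (length-snoc s m) s+1≤r
Growth-∷ m r (s ∷ R) j st stR j∈ | inj₂ (j′ , refl , j′∈) with isStandard-∷∷⁻ r s (addToRow m j′ R) st
... | good , fits , _ =
  isStandard-∷∷⁺ r s R good fits stR ,
  suc (suc j′) , suc∈addableRows r (s ∷ R) (suc∈addableRows′ (length r) s R j′∈) , refl

Growth-snocMax : ∀ m r₀ X → isStandard ((r₀ ++ [ m ]) ∷ X) ≡ true → All (All (_≤ m)) X → m ∉ r₀ → m ∉ concat X →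
  Growth m (removeEntry m ((r₀ ++ [ m ]) ∷ X)) ((r₀ ++ [ m ]) ∷ X)
Growth-snocMax m [] [] _ _ _ _ rewrite ≡ᵇ-refl m = refl , zero , here refl , refl
Growth-snocMax m [] (s ∷ X) st (s≤m ∷ _) _ _ with isStandard-∷∷⁻ [ m ] s X st
... | _ , (_ , ok) , st′ = contradiction (columnsOK-below-max m [] s ok s≤m) (<⇒≱ (proj₁ (isStandard-head s X st′)))
Growth-snocMax m r₀@(_ ∷ _) X st X≤m m∉r₀ m∉X
  rewrite erase-snoc m r₀ m∉r₀ | removeEntry-∉ m X (rows-nonEmpty X (isStandard-tail _ X st)) m∉X =
  unsnoc X st X≤m , zero , here refl , refl
  where
  unsnoc : ∀ X → isStandard ((r₀ ++ [ m ]) ∷ X) ≡ true → All (All (_≤ m)) X → isStandard (r₀ ∷ X) ≡ true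
  unsnoc [] st _ =
    isStandard-[ r₀ ]⁺ (s≤s z≤n , strictlyIncreasing-++⁻ˡ r₀ [ m ] (proj₂ (isStandard-[ r₀ ++ [ m ] ]⁻ st)))
  unsnoc (s ∷ X) st (s≤m ∷ _) with isStandard-∷∷⁻ (r₀ ++ [ m ]) s X st
  ... | (_ , inc) , (_ , ok) , st′ =
    isStandard-∷∷⁺ r₀ s X (s≤s z≤n , strictlyIncreasing-++⁻ˡ r₀ [ m ] inc)
      (s≤r₀ , columnsOK-++⁻ˡ r₀ [ m ] s ok s≤r₀) st′
    where
    s≤r₀ = columnsOK-below-max m r₀ s ok s≤m

-- The maximal entry sits at the end of its row, so removing it undoes a growth.
removeEntry-Growth : ∀ m T′ → isStandard T′ ≡ true → All (All (_≤ m)) T′ → m ∈ concat T′ → Unique (concat T′) →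
  Growth m (removeEntry m T′) T′
removeEntry-Growth m (r ∷ X) st (r≤m ∷ X≤m) m∈ u with ∈-++⁻ r m∈
... | inj₁ m∈r with max-last m r (proj₂ (isStandard-head r X st)) r≤m m∈r
...   | r₀ , refl = Growth-snocMax m r₀ X st X≤m
          (λ m∈r₀ → Unique-++-disjoint r₀ [ m ] (Unique-++⁻ˡ (r₀ ++ [ m ]) (concat X) u) m∈r₀ (here refl))
          (Unique-++-disjoint (r₀ ++ [ m ]) (concat X) u m∈r)
removeEntry-Growth m (r ∷ X) st (r≤m ∷ X≤m) m∈ u | inj₂ m∈X
  with removeEntry-Growth m X (isStandard-tail r X st) X≤m m∈X (Unique-++⁻ʳ r (concat X) u)
... | stR , j , j∈ , X≡
  rewrite removeEntry-∷ m r X (proj₁ (isStandard-head r X st)) (λ m∈r → Unique-++-disjoint r (concat X) u m∈r m∈X) =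
  subst (Growth m (r ∷ removeEntry m X)) (cong (r ∷_) (sym X≡))
    (Growth-∷ m r _ j (subst (λ Z → isStandard (r ∷ Z) ≡ true) X≡ st) stR j∈)

entries<suc : ∀ n T → IsPermutation n (concat T) → All (All (_< suc n)) T
entries<suc n T (_ , _ , range) = concat⁻ (All.map (s≤s ∘ proj₂) range)

max∉SYT : ∀ n T → T ∈ SYT n → suc n ∉ concat T
max∉SYT n T T∈ = suc∉InRange (proj₂ (proj₂ (proj₂ (∈-SYT⁻ n T T∈))))

addToRow∈SYT : ∀ n T j → T ∈ SYT n → j ∈ addableRows T → addToRow (suc n) j T ∈ SYT (suc n)
addToRow∈SYT n T j T∈ j∈ with ∈-SYT⁻ n T T∈
... | st , isPerm = ∈-SYT⁺ (suc n) _
  ( isStandard-addToRow (suc n) T j st (entries<suc n T isPerm) j∈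
  , addMax (addToRow-↭ (suc n) j T) isPerm)

SYT-suc⁺ : ∀ n {T₀′} → T₀′ ∈ SYT (suc n) → T₀′ ∈ concatMap (growths (suc n)) (SYT n)
SYT-suc⁺ n {T₀′} T₀′∈ with ∈-SYT⁻ (suc n) T₀′ T₀′∈
... | st , isPerm@(_ , u , range)
  with removeEntry-Growth (suc n) T₀′ st (concat⁻ (All.map proj₂ range)) (max∈permutation n (concat T₀′) isPerm) u
... | stT , j , j∈ , T₀′≡ = ∈-concatMap⁺′ (growths (suc n)) (∈-SYT⁺ n T₀ (stT , removeMax concat-↭ isPerm))
  (subst (_∈ growths (suc n) T₀) (sym T₀′≡) (∈-map⁺ (λ j → addToRow (suc n) j T₀) j∈))
  where
  T₀ = removeEntry (suc n) T₀′
  concat-↭ : concat T₀′ ↭ suc n ∷ concat T₀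
  concat-↭ = subst (λ Z → concat Z ↭ suc n ∷ concat T₀) (sym T₀′≡) (addToRow-↭ (suc n) j T₀)

SYT-suc⁻ : ∀ n {T′} → T′ ∈ concatMap (growths (suc n)) (SYT n) → T′ ∈ SYT (suc n)
SYT-suc⁻ n T′∈ with ∈-concatMap⁻′ (growths (suc n)) (SYT n) T′∈
... | T , T∈ , T′∈growths with ∈-map⁻ (λ j → addToRow (suc n) j T) T′∈growths
... | j , j∈ , refl = addToRow∈SYT n T j T∈ j∈

growths-SYT-unique : ∀ n → Unique (concatMap (growths (suc n)) (SYT n))
growths-SYT-unique n = concatMap-unique (growths (suc n)) (removeEntry (suc n)) (SYT n) (SYT-unique n)
  growths-unique removeEntry-growth
  where
  m = suc n
  growths-unique : ∀ {T} → T ∈ SYT n → Unique (growths m T)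
  growths-unique {T} T∈ = map-unique (λ j → addToRow m j T) (addableRows T) (addableRows-unique T)
    λ {j} {j′} j∈ j′∈ eq → trans (sym (rowOf-addToRow m j T (addableRows≤length T j∈) (max∉SYT n T T∈)))
                                 (trans (cong (rowOf m) eq) (rowOf-addToRow m j′ T (addableRows≤length T j′∈) (max∉SYT n T T∈)))
  removeEntry-growth : ∀ {T T′} → T ∈ SYT n → T′ ∈ growths m T → removeEntry m T′ ≡ T
  removeEntry-growth {T} T∈ T′∈ with ∈-map⁻ (λ j → addToRow m j T) T′∈
  ... | j , _ , refl = removeEntry-addToRow m j T (rows-nonEmpty T (proj₁ (∈-SYT⁻ n T T∈))) (max∉SYT n T T∈)

newColumn : ℕ → Tableau → ℕ
newColumn j [] = 1
newColumn zero (r ∷ T) = suc (length r)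
newColumn (suc j) (r ∷ T) = newColumn j T

elemᵇ-++ : ∀ i r s → elemᵇ i (r ++ s) ≡ elemᵇ i r ∨ elemᵇ i s
elemᵇ-++ i [] s = refl
elemᵇ-++ i (x ∷ r) s rewrite elemᵇ-++ i r s with i ≡ᵇ x
... | true  = refl
... | false = refl

posInRow-++ : ∀ i r s → i ∈ r → posInRow i (r ++ s) ≡ posInRow i r
posInRow-++ i (x ∷ r) s i∈ with x ≡ᵇ i in x≡ᵇi
... | true  = refl
... | false with i∈
...   | here refl = contradiction (≡ᵇ-refl i) (λ e → contradiction (trans (sym e) x≡ᵇi) λ ())
...   | there i∈r rewrite ∈⇒elemᵇ-true (r ++ s) (∈-++⁺ˡ i∈r) | ∈⇒elemᵇ-true r i∈r = cong suc (posInRow-++ i r s i∈r)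

posInRow-snoc : ∀ m r → m ∉ r → posInRow m (r ++ [ m ]) ≡ suc (length r)
posInRow-snoc m [] _ rewrite ≡ᵇ-refl m = refl
posInRow-snoc m (x ∷ r) m∉
  rewrite ≢⇒≡ᵇ-false {x} {m} (m∉ ∘ here ∘ sym) | ∈⇒elemᵇ-true (r ++ [ m ]) (∈-++⁺ʳ r (here refl)) =
  cong suc (posInRow-snoc m r (m∉ ∘ there))

columnOf-addToRow-other : ∀ i m j T → i ≢ m → columnOf i (addToRow m j T) ≡ columnOf i T
columnOf-addToRow-other i m j [] i≢m rewrite ≢⇒≡ᵇ-false i≢m = refl
columnOf-addToRow-other i m zero (r ∷ T) i≢m
  rewrite elemᵇ-++ i r [ m ] | ≢⇒≡ᵇ-false i≢m | ∨-identityʳ (elemᵇ i r) with elemᵇ i r in i∈?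
... | true  = posInRow-++ i r [ m ] (elemᵇ-sound r i∈?)
... | false = refl
columnOf-addToRow-other i m (suc j) (r ∷ T) i≢m with elemᵇ i r
... | true  = refl
... | false = columnOf-addToRow-other i m j T i≢m

columnOf-addToRow : ∀ m j T → m ∉ concat T → columnOf m (addToRow m j T) ≡ newColumn j T
columnOf-addToRow m j [] _ rewrite ≡ᵇ-refl m = refl
columnOf-addToRow m zero (r ∷ T) m∉ rewrite ∈⇒elemᵇ-true (r ++ [ m ]) (∈-++⁺ʳ r (here refl)) =
  posInRow-snoc m r (m∉ ∘ ∈-++⁺ˡ)
columnOf-addToRow m (suc j) (r ∷ T) m∉ rewrite ∉⇒elemᵇ-false r (m∉ ∘ ∈-++⁺ˡ) =
  columnOf-addToRow m j T (m∉ ∘ ∈-++⁺ʳ r)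

cellAtMost : ℕ → Maybe ℕ → Bool
cellAtMost i nothing = false
cellAtMost i (just x) = x ≤ᵇ i

-- col is defined through a helper local to Defs; with-abstracting the first entry makes that helper
-- appear applied to a variable, so that it can be inferred as f below.
countᵇ-entry : ∀ k i (f : Maybe ℕ → Bool) y T → f nothing ≡ false → (∀ x → f (just x) ≡ (x ≤ᵇ i)) →
  indicator (f y) + countᵇ (λ r → f (entry k r)) T ≡ indicator (cellAtMost i y) + countᵇ (cellAtMost i ∘ entry k) T
countᵇ-entry k i f y T f-nothing f-just = cong₂ _+_ (agree y) (go T)
  where
  agree : ∀ y → indicator (f y) ≡ indicator (cellAtMost i y)
  agree nothing rewrite f-nothing = refl
  agree (just x) rewrite f-just x = refl
  go : ∀ T → countᵇ (λ r → f (entry k r)) T ≡ countᵇ (cellAtMost i ∘ entry k) T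
  go [] = refl
  go (r ∷ T) = cong₂ _+_ (agree (entry k r)) (go T)

col≡countᵇ : ∀ k T i → col k T i ≡ countᵇ (cellAtMost i ∘ entry k) T
col≡countᵇ k [] i = refl
col≡countᵇ k (r ∷ T) i with entry k r
... | y = countᵇ-entry k i _ y T refl (λ _ → refl)

countᵇ-cong : {A : Set} (p q : A → Bool) (xs : List A) → (∀ {x} → x ∈ xs → p x ≡ q x) → countᵇ p xs ≡ countᵇ q xs
countᵇ-cong p q [] _ = refl
countᵇ-cong p q (x ∷ xs) eq rewrite eq (here refl) = cong (_ +_) (countᵇ-cong p q xs (eq ∘ there))

cellAtMost-snoc : ∀ i m k r → i < m → cellAtMost i (entry k (r ++ [ m ])) ≡ cellAtMost i (entry k r)
cellAtMost-snoc i m zero [] _ = refl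
cellAtMost-snoc i m (suc zero) [] i<m = >⇒≤ᵇ-false i<m
cellAtMost-snoc i m (suc (suc k)) [] _ = refl
cellAtMost-snoc i m zero (x ∷ r) _ = refl
cellAtMost-snoc i m (suc zero) (x ∷ r) _ = refl
cellAtMost-snoc i m (suc (suc k)) (x ∷ r) i<m = cellAtMost-snoc i m (suc k) r i<m

col-addToRow-other : ∀ i m k j T → i < m → col k (addToRow m j T) i ≡ col k T i
col-addToRow-other i m k j T i<m = trans (col≡countᵇ k (addToRow m j T) i) (trans (go j T) (sym (col≡countᵇ k T i)))
  where
  go : ∀ j T → countᵇ (cellAtMost i ∘ entry k) (addToRow m j T) ≡ countᵇ (cellAtMost i ∘ entry k) T
  go j [] rewrite cellAtMost-snoc i m k [] i<m = refl
  go zero (r ∷ T) rewrite cellAtMost-snoc i m k r i<m = refl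
  go (suc j) (r ∷ T) = cong (_ +_) (go j T)

σ-cong : ∀ i A B → columnOf i A ≡ columnOf i B → (∀ k → col k A i ≡ col k B i) → σ i A ≡ σ i B
σ-cong i A B same-column same-col with columnOf i A | columnOf i B
σ-cong i A B refl same-col | zero | zero = refl
σ-cong i A B refl same-col | suc zero | suc zero = cong (λ c → i ∸ c + 1) (same-col 1)
σ-cong i A B refl same-col | suc (suc k) | suc (suc k) =
  cong₂ (λ a b → a ∸ b + 1) (same-col (suc k)) (same-col (suc (suc k)))

σ-addToRow-other : ∀ i m j T → i < m → σ i (addToRow m j T) ≡ σ i T
σ-addToRow-other i m j T i<m =
  σ-cong i (addToRow m j T) T (columnOf-addToRow-other i m j T (<⇒≢ i<m)) (λ k → col-addToRow-other i m k j T i<m)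

columnHeight : ℕ → Tableau → ℕ
columnHeight k X = countᵇ (λ r → k ≤ᵇ length r) X

cellAtMost-entry : ∀ i k r → All (_≤ i) r → cellAtMost i (entry (suc k) r) ≡ (suc k ≤ᵇ length r)
cellAtMost-entry i k [] _ = refl
cellAtMost-entry i zero (x ∷ r) (x≤i ∷ _) = ≤⇒≤ᵇ-true x≤i
cellAtMost-entry i (suc k) (x ∷ r) (_ ∷ r≤i) = cellAtMost-entry i k r r≤i

col≡columnHeight : ∀ i k X → All (All (_≤ i)) X → col (suc k) X i ≡ columnHeight (suc k) X
col≡columnHeight i k X X≤i =
  trans (col≡countᵇ (suc k) X i) (countᵇ-cong _ _ X (λ {r} r∈ → cellAtMost-entry i k r (All.lookup X≤i r∈)))

columnHeight-shorter : ∀ p Y → All (λ r → length r < p) Y → columnHeight p Y ≡ 0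
columnHeight-shorter p [] _ = refl
columnHeight-shorter p (s ∷ Y) (s<p ∷ rest) rewrite >⇒≤ᵇ-false {p} {length s} s<p = columnHeight-shorter p Y rest

σ-column1 : ∀ i T → columnOf i T ≡ 1 → σ i T ≡ i ∸ col 1 T i + 1
σ-column1 i T e rewrite e = refl

σ-column≥2 : ∀ i T k → columnOf i T ≡ suc (suc k) → σ i T ≡ col (suc k) T i ∸ col (suc (suc k)) T i + 1
σ-column≥2 i T k e rewrite e = refl

All<⇒∉ : ∀ {m} (r : List ℕ) → All (_< m) r → m ∉ r
All<⇒∉ r r<m m∈ = <-irrefl refl (All.lookup r<m m∈)

addToRow-≤ : ∀ m j T → All (All (_≤ m)) T → All (All (_≤ m)) (addToRow m j T)
addToRow-≤ m j [] _ = (≤-refl ∷ []) ∷ []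
addToRow-≤ m zero (r ∷ T) (r≤m ∷ T≤m) = ++⁺ r≤m (≤-refl ∷ []) ∷ T≤m
addToRow-≤ m (suc j) (r ∷ T) (r≤m ∷ T≤m) = r≤m ∷ addToRow-≤ m j T T≤m

-- Column heights k and k+1 both grow by one when a row of length ≥ k+1 is put below.
σ-∷ : ∀ m r X k → m ∉ r → All (_≤ m) r → All (All (_≤ m)) X →
  columnOf m X ≡ suc (suc k) → suc (suc k) ≤ length r → σ m (r ∷ X) ≡ σ m X
σ-∷ m r X k m∉r r≤m X≤m column k+2≤r =
  trans (σ-column≥2 m (r ∷ X) k column′) (trans heights (sym (σ-column≥2 m X k column)))
  where
  column′ : columnOf m (r ∷ X) ≡ suc (suc k)
  column′ rewrite ∉⇒elemᵇ-false r m∉r = column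
  heights : col (suc k) (r ∷ X) m ∸ col (suc (suc k)) (r ∷ X) m + 1 ≡ col (suc k) X m ∸ col (suc (suc k)) X m + 1
  heights rewrite col≡columnHeight m k (r ∷ X) (r≤m ∷ X≤m) | col≡columnHeight m (suc k) (r ∷ X) (r≤m ∷ X≤m)
                | col≡columnHeight m k X X≤m | col≡columnHeight m (suc k) X X≤m
                | ≤⇒≤ᵇ-true {suc k} {length r} (≤-trans (n≤1+n _) k+2≤r)
                | ≤⇒≤ᵇ-true {suc (suc k)} {length r} k+2≤r = refl

positive⇒suc : ∀ {n} → 0 < n → ∃ λ k → n ≡ suc k
positive⇒suc (s≤s {n = k} _) = k , refl

σ-snocFirst : ∀ m s Y → All (_< m) s → All (All (_< m)) Y → 0 < length s → All (λ r → length r ≤ length s) Y →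
  σ m ((s ++ [ m ]) ∷ Y) ≡ suc (columnHeight (length s) Y)
σ-snocFirst m s Y s<m Y<m 0<s Y≤s with positive⇒suc 0<s
... | k , s≡ = trans (σ-column≥2 m X k column) (trans heights (cong (λ c → suc (columnHeight c Y)) (sym s≡)))
  where
  X = (s ++ [ m ]) ∷ Y
  column : columnOf m X ≡ suc (suc k)
  column = trans (columnOf-addToRow m 0 (s ∷ Y) (All<⇒∉ (concat (s ∷ Y)) (concat⁺ (s<m ∷ Y<m)))) (cong suc s≡)
  X≤m : All (All (_≤ m)) X
  X≤m = addToRow-≤ m 0 (s ∷ Y) (All.map (All.map <⇒≤) (s<m ∷ Y<m))
  s+m≡ : length (s ++ [ m ]) ≡ suc (suc k)
  s+m≡ = trans (length-snoc s m) (cong suc s≡)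
  none : columnHeight (suc (suc k)) Y ≡ 0
  none = columnHeight-shorter (suc (suc k)) Y (All.map (λ r≤s → s≤s (subst (_ ≤_) s≡ r≤s)) Y≤s)
  heights : col (suc k) X m ∸ col (suc (suc k)) X m + 1 ≡ suc (columnHeight (suc k) Y)
  heights rewrite col≡columnHeight m k X X≤m | col≡columnHeight m (suc k) X X≤m | s+m≡
                | ≤⇒≤ᵇ-true {suc k} {suc (suc k)} (n≤1+n (suc k)) | ≤⇒≤ᵇ-true {suc (suc k)} {suc (suc k)} ≤-refl
                | none = +-comm (columnHeight (suc k) Y) 1

newColumn-length : ∀ T → newColumn (length T) T ≡ 1
newColumn-length [] = refl
newColumn-length (r ∷ T) = newColumn-length T

columnHeight1-newRow : ∀ m T → All (λ r → 0 < length r) T → columnHeight 1 (addToRow m (length T) T) ≡ suc (length T)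
columnHeight1-newRow m [] _ = refl
columnHeight1-newRow m (r ∷ T) (0<r ∷ rest) rewrite ≤⇒≤ᵇ-true {1} {length r} 0<r = cong suc (columnHeight1-newRow m T rest)

σ-newRow : ∀ m T → All (All (_< m)) T → All (λ r → 0 < length r) T → length T < m →
  σ m (addToRow m (length T) T) ≡ m ∸ length T
σ-newRow m T T<m nonEmpty ℓ<m = begin
    σ m (addToRow m (length T) T)
      ≡⟨ σ-column1 m (addToRow m (length T) T)
           (trans (columnOf-addToRow m (length T) T (All<⇒∉ (concat T) (concat⁺ T<m))) (newColumn-length T)) ⟩
    m ∸ col 1 (addToRow m (length T) T) m + 1
      ≡⟨ cong (λ c → m ∸ c + 1) (col≡columnHeight m 0 _ (addToRow-≤ m (length T) T (All.map (All.map <⇒≤) T<m))) ⟩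
    m ∸ columnHeight 1 (addToRow m (length T) T) + 1
      ≡⟨ cong (λ c → m ∸ c + 1) (columnHeight1-newRow m T nonEmpty) ⟩
    m ∸ suc (length T) + 1
      ≡⟨ +-comm (m ∸ suc (length T)) 1 ⟩
    suc (m ∸ suc (length T))
      ≡⟨ sym (+-∸-assoc 1 ℓ<m) ⟩
    m ∸ length T ∎
  where open ≡-Reasoning

cornerRows′-newColumn : ∀ p Y {j} → j ∈ cornerRows′ p Y → isStandard Y ≡ true → All (λ r → length r ≤ p) Y →
  ∃ λ k → newColumn j Y ≡ suc (suc k) × suc (suc k) ≤ p
cornerRows′-newColumn p (s ∷ Y) j∈ st (s≤p ∷ _) with ∈-++⁻ (if length s <ᵇ p then [ 0 ] else []) j∈
... | inj₂ j∈suc with ∈-map⁻ suc j∈suc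
...   | j′ , j′∈ , refl with cornerRows′-newColumn (length s) Y j′∈ (isStandard-tail s Y st) (rows-shorter s Y st)
...     | k , column , k+2≤s = k , column , ≤-trans k+2≤s s≤p
cornerRows′-newColumn p (s ∷ Y) j∈ st _ | inj₁ _ with length s <ᵇ p in s<?p
cornerRows′-newColumn p (s ∷ Y) j∈ st _ | inj₁ (here refl) | true with positive⇒suc (proj₁ (isStandard-head s Y st))
... | k , s≡ = k , cong suc s≡ , subst (_< p) s≡ (<ᵇ-sound s<?p)

length-addToRow-corner : ∀ m j T → j < length T → length (addToRow m j T) ≡ length T
length-addToRow-corner m zero (r ∷ T) _ = refl
length-addToRow-corner m (suc j) (r ∷ T) (s≤s j<T) = cong suc (length-addToRow-corner m j T j<T)

length-addToRow-new : ∀ m T → length (addToRow m (length T) T) ≡ suc (length T)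
length-addToRow-new m [] = refl
length-addToRow-new m (r ∷ T) = cong suc (length-addToRow-new m T)

∑σ-cornerRows′-∷ : ∀ m s Y → isStandard (s ∷ Y) ≡ true → All (_< m) s → All (All (_< m)) Y →
  ∑ (map suc (cornerRows′ (length s) Y)) (λ j → σ m (addToRow m j (s ∷ Y)))
    ≡ ∑ (cornerRows′ (length s) Y) (λ j → σ m (addToRow m j Y))
∑σ-cornerRows′-∷ m s Y st s<m Y<m = trans (∑-map suc C _) (∑-cong C λ {j} j∈ →
  let k , column , k+2≤s = cornerRows′-newColumn (length s) Y j∈ (isStandard-tail s Y st) (rows-shorter s Y st) in
  σ-∷ m s (addToRow m j Y) k (All<⇒∉ s s<m) (All.map <⇒≤ s<m) (addToRow-≤ m j Y (All.map (All.map <⇒≤) Y<m))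
    (trans (columnOf-addToRow m j Y (All<⇒∉ (concat Y) (concat⁺ Y<m))) column) k+2≤s)
  where
  C = cornerRows′ (length s) Y

-- Adding m to the lowest row of a block of rows of equal length gives σ = size of the block, and the
-- blocks partition the rows; columnHeight p Y counts the rows continuing the block of the row below Y.
∑σ-cornerRows′ : ∀ m p Y → isStandard Y ≡ true → All (All (_< m)) Y → All (λ r → length r ≤ p) Y →
  ∑ (cornerRows′ p Y) (λ j → σ m (addToRow m j Y)) + columnHeight p Y ≡ length Y
∑σ-cornerRows′ m p [] _ _ _ = refl
∑σ-cornerRows′ m p (s ∷ Y) st (s<m ∷ Y<m) (s≤p ∷ _) with length s <ᵇ p in s<?p
... | true = begin
    (σ m ((s ++ [ m ]) ∷ Y) + ∑ (map suc C) g) + (indicator (p ≤ᵇ length s) + columnHeight p Y)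
      ≡⟨ cong₂ _+_ (cong₂ _+_ (σ-snocFirst m s Y s<m Y<m 0<s Y≤s) (∑σ-cornerRows′-∷ m s Y st s<m Y<m)) above-empty ⟩
    (suc h + Q) + 0
      ≡⟨ +-identityʳ _ ⟩
    suc (h + Q)
      ≡⟨ cong suc (trans (+-comm h Q) IH) ⟩
    suc (length Y) ∎
  where
  open ≡-Reasoning
  C = cornerRows′ (length s) Y
  g = λ j → σ m (addToRow m j (s ∷ Y))
  Q = ∑ C (λ j → σ m (addToRow m j Y))
  h = columnHeight (length s) Y
  0<s = proj₁ (isStandard-head s Y st)
  Y≤s = rows-shorter s Y st
  IH = ∑σ-cornerRows′ m (length s) Y (isStandard-tail s Y st) Y<m Y≤s
  above-empty : indicator (p ≤ᵇ length s) + columnHeight p Y ≡ 0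
  above-empty rewrite >⇒≤ᵇ-false {p} {length s} (<ᵇ-sound s<?p) =
    columnHeight-shorter p Y (All.map (λ r≤s → <-≤-trans (s≤s r≤s) (<ᵇ-sound s<?p)) Y≤s)
... | false = begin
    ∑ (map suc C) g + (indicator (p ≤ᵇ length s) + columnHeight p Y)
      ≡⟨ cong₂ _+_ (∑σ-cornerRows′-∷ m s Y st s<m Y<m) same-length ⟩
    Q + suc h
      ≡⟨ +-suc Q h ⟩
    suc (Q + h)
      ≡⟨ cong suc IH ⟩
    suc (length Y) ∎
  where
  open ≡-Reasoning
  C = cornerRows′ (length s) Y
  g = λ j → σ m (addToRow m j (s ∷ Y))
  Q = ∑ C (λ j → σ m (addToRow m j Y))
  h = columnHeight (length s) Y
  IH = ∑σ-cornerRows′ m (length s) Y (isStandard-tail s Y st) Y<m (rows-shorter s Y st)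
  same-length : indicator (p ≤ᵇ length s) + columnHeight p Y ≡ suc h
  same-length rewrite ≤-antisym (<ᵇ-false⇒≥ s<?p) s≤p | ≤⇒≤ᵇ-true (≤-refl {length s}) = refl

∑σ-cornerRows : ∀ m T → isStandard T ≡ true → All (All (_< m)) T →
  ∑ (cornerRows T) (λ j → σ m (addToRow m j T)) ≡ length T
∑σ-cornerRows m [] _ _ = refl
∑σ-cornerRows m (r ∷ Y) st (r<m ∷ Y<m) = begin
    σ m ((r ++ [ m ]) ∷ Y) + ∑ (map suc C) (λ j → σ m (addToRow m j (r ∷ Y)))
      ≡⟨ cong₂ _+_ (σ-snocFirst m r Y r<m Y<m (proj₁ (isStandard-head r Y st)) Y≤r)
                   (∑σ-cornerRows′-∷ m r Y st r<m Y<m) ⟩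
    suc (h + Q)
      ≡⟨ cong suc (trans (+-comm h Q) (∑σ-cornerRows′ m (length r) Y (isStandard-tail r Y st) Y<m Y≤r)) ⟩
    suc (length Y) ∎
  where
  open ≡-Reasoning
  C = cornerRows′ (length r) Y
  Q = ∑ C (λ j → σ m (addToRow m j Y))
  h = columnHeight (length r) Y
  Y≤r = rows-shorter r Y st

∑σ-addableRows : ∀ n T (h : ℕ → ℕ) → isStandard T ≡ true → All (All (_< suc n)) T → length T ≤ n →
  ∑ (addableRows T) (λ j → σ (suc n) (addToRow (suc n) j T) * h (length (addToRow (suc n) j T))) ≡ step n h (length T)
∑σ-addableRows n T h st T<m ℓ≤n = begin
    ∑ (cornerRows T ++ [ length T ]) f
      ≡⟨ ∑-++ (cornerRows T) [ length T ] f ⟩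
    ∑ (cornerRows T) f + (f (length T) + 0)
      ≡⟨ cong₂ _+_ corners (trans (+-identityʳ _) newRow) ⟩
    length T * h (length T) + (suc n ∸ length T) * h (suc (length T)) ∎
  where
  open ≡-Reasoning
  m = suc n
  f = λ j → σ m (addToRow m j T) * h (length (addToRow m j T))
  corners : ∑ (cornerRows T) f ≡ length T * h (length T)
  corners = begin
    ∑ (cornerRows T) f
      ≡⟨ ∑-cong (cornerRows T) (λ {j} j∈ → cong (λ ℓ → σ m (addToRow m j T) * h ℓ)
                                            (length-addToRow-corner m j T (cornerRows<length T j∈))) ⟩
    ∑ (cornerRows T) (λ j → σ m (addToRow m j T) * h (length T))
      ≡⟨ ∑-*ʳ (cornerRows T) (h (length T)) (λ j → σ m (addToRow m j T)) ⟩
    ∑ (cornerRows T) (λ j → σ m (addToRow m j T)) * h (length T)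
      ≡⟨ cong (_* h (length T)) (∑σ-cornerRows m T st T<m) ⟩
    length T * h (length T) ∎
  newRow : f (length T) ≡ (suc n ∸ length T) * h (suc (length T))
  newRow = cong₂ _*_ (σ-newRow m T T<m (rows-nonEmpty T st) (s≤s ℓ≤n)) (cong h (length-addToRow-new m T))

oneTo-suc : ∀ n → oneTo (suc n) ≡ oneTo n ++ [ suc n ]
oneTo-suc n = trans (cong (map suc) (sym (upTo-∷ʳ n))) (map-++ suc (upTo n) [ n ])

weight-addToRow : ∀ n j T → weight (suc n) (addToRow (suc n) j T) ≡ weight n T * σ (suc n) (addToRow (suc n) j T)
weight-addToRow n j T = begin
    product (map (λ i → σ i X) (oneTo (suc n)))
      ≡⟨ cong (λ is → product (map (λ i → σ i X) is)) (oneTo-suc n) ⟩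
    product (map (λ i → σ i X) (oneTo n ++ [ suc n ]))
      ≡⟨ cong product (map-++ (λ i → σ i X) (oneTo n) [ suc n ]) ⟩
    product (map (λ i → σ i X) (oneTo n) ++ [ σ (suc n) X ])
      ≡⟨ product-++ (map (λ i → σ i X) (oneTo n)) [ σ (suc n) X ] ⟩
    product (map (λ i → σ i X) (oneTo n)) * (σ (suc n) X * 1)
      ≡⟨ cong₂ _*_ (product-cong (oneTo n) λ i∈ → σ-addToRow-other _ (suc n) j T (s≤s (proj₂ (∈-oneTo⁻ i∈))))
                   (*-identityʳ _) ⟩
    weight n T * σ (suc n) X ∎
  where
  open ≡-Reasoning
  X = addToRow (suc n) j T

∑-weight-SYT-suc : ∀ n (h : ℕ → ℕ) →
  ∑ (SYT (suc n)) (λ T → weight (suc n) T * h (ℓ T)) ≡ ∑ (SYT n) (λ T → weight n T * step n h (ℓ T))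
∑-weight-SYT-suc n h = begin
    ∑ (SYT (suc n)) F
      ≡⟨ ∑-unique F (SYT-unique (suc n)) (growths-SYT-unique n) (SYT-suc⁺ n) (SYT-suc⁻ n) ⟩
    ∑ (concatMap (growths m) (SYT n)) F
      ≡⟨ ∑-concatMap (growths m) (SYT n) F ⟩
    ∑ (SYT n) (λ T → ∑ (growths m T) F)
      ≡⟨ ∑-cong (SYT n) growthStep ⟩
    ∑ (SYT n) (λ T → weight n T * step n h (ℓ T)) ∎
  where
  open ≡-Reasoning
  m = suc n
  F = λ T → weight m T * h (ℓ T)
  growthStep : ∀ {T} → T ∈ SYT n → ∑ (growths m T) F ≡ weight n T * step n h (ℓ T)
  growthStep {T} T∈ with ∈-SYT⁻ n T T∈
  ... | st , isPerm = begin
      ∑ (growths m T) F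
        ≡⟨ ∑-map (λ j → addToRow m j T) (addableRows T) F ⟩
      ∑ (addableRows T) (λ j → weight m (addToRow m j T) * h (length (addToRow m j T)))
        ≡⟨ ∑-cong (addableRows T) (λ {j} _ → trans (cong (_* h (length (addToRow m j T))) (weight-addToRow n j T))
                                                   (*-assoc (weight n T) _ _)) ⟩
      ∑ (addableRows T) (λ j → weight n T * (σ m (addToRow m j T) * h (length (addToRow m j T))))
        ≡⟨ ∑-*ˡ (addableRows T) (weight n T) _ ⟩
      weight n T * ∑ (addableRows T) (λ j → σ m (addToRow m j T) * h (length (addToRow m j T)))
        ≡⟨ cong (weight n T *_) (∑σ-addableRows n T h st (entries<suc n T isPerm) ℓ≤n) ⟩
      weight n T * step n h (ℓ T) ∎
    where
    ℓ≤n : length T ≤ n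
    ℓ≤n = ≤-trans (length≤length-concat T (rows-nonEmpty T st)) (≤-reflexive (proj₁ isPerm))

∑-des≡∑-weight : ∀ n (h : ℕ → ℕ) → ∑ (perms n) (h ∘ des) ≡ ∑ (SYT n) (λ T → weight n T * h (ℓ T))
∑-des≡∑-weight zero h = cong (_+ 0) (sym (*-identityˡ (h 0)))
∑-des≡∑-weight (suc n) h =
  trans (∑-des-perms-suc n h) (trans (∑-des≡∑-weight n (step n h)) (sym (∑-weight-SYT-suc n h)))

theorem4p6 : (n : ℕ) → 1 ≤ n → (k : ℕ) → eulerianCoeff n k ≡ sytCoeff n k
-- The identity holds for n = 0 as well.
theorem4p6 n _ k = begin
    countᵇ (λ π → des π ≡ᵇ k) (perms n)
      ≡⟨ countᵇ≡∑ (λ π → des π ≡ᵇ k) (perms n) ⟩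
    ∑ (perms n) (λ π → indicator (des π ≡ᵇ k))
      ≡⟨ ∑-des≡∑-weight n (λ d → indicator (d ≡ᵇ k)) ⟩
    ∑ (SYT n) (λ T → weight n T * indicator (ℓ T ≡ᵇ k))
      ≡⟨ ∑-cong (SYT n) (λ {T} _ → weight-if (weight n T) (ℓ T ≡ᵇ k)) ⟩
    ∑ (SYT n) (λ T → if ℓ T ≡ᵇ k then weight n T else 0)
      ≡⟨ ∑-filterᵇ (λ T → ℓ T ≡ᵇ k) (SYT n) (weight n) ⟨
    sytCoeff n k ∎
  where
  open ≡-Reasoning
  weight-if : ∀ w b → w * indicator b ≡ (if b then w else 0)
  weight-if w true = *-identityʳ w
  weight-if w false = *-zeroʳ w
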